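{- Let $r_1,r_2\in\mathbb{Z}$ and let $(U_n)_{n\ge0}$ be a sequence of integers with $U_n=r_1U_{n-1}+r_2U_{n-2}$ for all $n\ge2$, where the roots of $x^2-r_1x-r_2$ are distinct. Then for every even $t\in\mathbb{N}_+$ the sequence $(U_{n^t})_{n\ge1}$ almost satisfies the Dold condition.
   Context: A sequence of integers $(A_n)_{n\ge1}$ satisfies the Dold condition if $n\mid\sum_{d\mid n}\mu(d)A_{n/d}$ for every $n\in\mathbb{N}_+$ ($\mu$ the Möbius function). It almost satisfies the Dold condition if there is $c\in\mathbb{N}_+$ such that $(cA_n)_{n\ge1}$ satisfies the Dold condition. -}

module Defs where

open import Data.Nat as ℕ using (ℕ; zero; suc; NonZero; _^_)
open import Data.Nat.Divisibility using (_∣?_)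
open import Data.Nat.Primality using (prime?)
open import Data.Nat.DivMod using (_/_)
open import Data.Integer as ℤ using (ℤ; +_; -_; _*_; _+_; _-_)
open import Data.Integer.Divisibility using (_∣_)
open import Data.Bool using (Bool; true; false; not)
open import Data.List using (List; length; filter; foldr; map; upTo)
open import Data.Bool.ListAction using (any)
open import Data.Product using (Σ; _×_)
open import Relation.Nullary using (¬_)
open import Relation.Nullary.Decidable using (does)
open import Relation.Binary.PropositionalEquality using (_≡_)

divisors : ℕ → List ℕ
divisors n = filter (λ d → d ∣? n) (map suc (upTo n))

ω : ℕ → ℕ
ω n = length (filter prime? (divisors n))

squarefree? : ℕ → Bool
squarefree? n = not (any (λ d → does ((suc (suc d) ℕ.* suc (suc d)) ∣? n)) (upTo n))

μ : ℕ → ℤ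
μ n with squarefree? n
... | true  = (- + 1) ℤ.^ ω n
... | false = + 0

sumℤ : List ℤ → ℤ
sumℤ = foldr _+_ (+ 0)

-- total division on ℕ (only used with d ∣ n, d ≥ 1)
_/′_ : ℕ → ℕ → ℕ
m /′ zero = 0
m /′ suc k = m / suc k

-- Dold condition for A : sequence indexed by n ≥ 1 (A n is the n-th term; A 0 unused)
Dold : (ℕ → ℤ) → Set
Dold A = ∀ (n : ℕ) → .{{_ : NonZero n}} →
  (+ n) ∣ sumℤ (map (λ d → μ d * A (n /′ d)) (divisors n))

AlmostDold : (ℕ → ℤ) → Set
AlmostDold A = Σ ℕ λ c → NonZero c × Dold (λ n → + c * A n)

IsLucasSeq : ℤ → ℤ → (ℕ → ℤ) → Set
IsLucasSeq r₁ r₂ U = ∀ n → U (suc (suc n)) ≡ r₁ * U (suc n) + r₂ * U n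

-- roots of x² - r₁x - r₂ distinct  ⇔  discriminant r₁² + 4 r₂ ≠ 0
DistinctRoots : ℤ → ℤ → Set
DistinctRoots r₁ r₂ = ¬ (r₁ * r₁ + + 4 * r₂ ≡ + 0)

module Submission where

-- Let ξ be a root of x² − r₁x − r₂ in ℤ[ξ]. Each U n is a fixed ℤ-linear function of ξⁿ, so it
-- suffices to compare powers of ξ modulo powers of a prime p. The Frobenius x ↦ xᵖ gives
-- ξ^(p²) ≡ ξ (mod p) when p ∤ 2D, D = r₁² + 4r₂ the discriminant, and ξ^(p⁴) ≡ ξ^(p²) (mod p) in
-- general. Since x ≡ y (mod pᵏ) implies xᵖ ≡ yᵖ (mod pᵏ⁺¹), for even t this lifts to
-- U((m p^(j+1))ᵗ) ≡ U((m pʲ)ᵗ) modulo p^(j+1), or modulo pʲ when p ∣ 2D; multiplying by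
-- c = 2|D| restores the missing factor p. For B n = c · U(nᵗ) these congruences give the
-- Dold condition: in ∑_{d ∣ n} μ(d) B(n/d) the divisors d and dp (p ∤ d) cancel modulo
-- p^(j+1) because μ(dp) = −μ(d), and a number divisible by every prime power dividing n is
-- divisible by n.

open import Defs
open import Level using (_⊔_; 0ℓ)
open import Algebra.Bundles using (CommutativeRing)
open import Algebra.Structures using (IsCommutativeRing)
open import Data.Bool using (Bool; true; false; if_then_else_; T; not)
open import Data.Bool.ListAction using (any)
open import Data.Bool.Properties using (T-≡)
open import Data.Fin as Fin using (Fin; inject₁; fromℕ)
import Data.Fin.Properties as Fin
open import Data.Integer as ℤ using (ℤ; +_; -[1+_])
import Data.Integer.Properties as ℤ
import Data.Integer.Divisibility.Signed as Signed
open import Data.Integer.Tactic.RingSolver using (solve-∀)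
open import Data.List using (List; []; _∷_; map; filter; upTo; length; _++_; _∷ʳ_)
import Data.List.Properties as List
open import Data.List.Membership.Propositional using (lose)
open import Data.List.Membership.Propositional.Properties using (∈-upTo⁺)
open import Data.List.Relation.Unary.All using (All; []; _∷_)
import Data.List.Relation.Unary.Any as Any
open import Data.List.Relation.Unary.Any.Properties using (any⁺; any⁻)
open import Data.Nat as ℕ using (ℕ; zero; suc; _≤_; _<_; z≤n; s≤s; NonZero)
import Data.Nat.Properties as ℕ
import Data.Nat.DivMod as ℕ
import Data.Nat.Tactic.RingSolver as ℕ
open import Data.Nat.Divisibility as ℕ using (_∣_; _∣?_; divides)
open import Data.Nat.Combinatorics using (_C_; nCn≡1; nC1≡n; nCk+nC[k+1]≡[n+1]C[k+1])
open import Data.Nat.Combinatorics.Specification using (k>n⇒nCk≡0)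
open import Data.Nat.Coprimality using (Coprime; coprime-divisor)
open import Data.Nat.ListAction using (product)
open import Data.Nat.Primality
  using (Prime; prime?; prime[2]; ¬prime[1]; irreducible[2]; euclidsLemma; prime⇒irreducible; prime⇒nonZero; prime⇒nonTrivial)
open import Data.Nat.Primality.Factorisation using (factorise)
open import Data.Product using (∃-syntax; _,_)
open import Data.Sum as Sum using (_⊎_; inj₁; inj₂; [_,_]′)
open import Function using (Equivalence)
open import Relation.Binary.Bundles using (Preorder)
open import Relation.Binary.Structures using (IsPreorder)
import Relation.Binary.Reasoning.Setoid as SetoidReasoning
import Relation.Binary.Reasoning.Preorder as PreorderReasoning
open import Relation.Binary.PropositionalEquality as ≡ using (_≡_; _≢_; refl; cong; cong₂; subst; subst₂; sym; trans)
open import Relation.Nullary using (¬_; Dec; yes; no; does; contradiction)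
open import Relation.Nullary.Decidable using (dec-true; dec-false)
open import Relation.Unary using (Pred; Decidable)

-- Natural numbers and primes

suc[k]*[1+n]C[1+k]≡[1+n]*nCk : ∀ n k → suc k ℕ.* (suc n C suc k) ≡ suc n ℕ.* (n C k)
suc[k]*[1+n]C[1+k]≡[1+n]*nCk zero zero = refl
suc[k]*[1+n]C[1+k]≡[1+n]*nCk zero (suc k)
  rewrite k>n⇒nCk≡0 {1} {suc (suc k)} (s≤s (s≤s z≤n)) | k>n⇒nCk≡0 {0} {suc k} (s≤s z≤n) = ℕ.*-zeroʳ k
suc[k]*[1+n]C[1+k]≡[1+n]*nCk (suc n) zero = trans (ℕ.+-identityʳ _) (trans (nC1≡n (suc (suc n))) (sym (ℕ.*-identityʳ _)))
suc[k]*[1+n]C[1+k]≡[1+n]*nCk (suc n) (suc k) = begin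
  suc (suc k) ℕ.* (suc (suc n) C suc (suc k))
    ≡⟨ cong (suc (suc k) ℕ.*_) (nCk+nC[k+1]≡[n+1]C[k+1] (suc n) (suc k)) ⟨
  suc (suc k) ℕ.* (suc n C suc k ℕ.+ suc n C suc (suc k))
    ≡⟨ distrib (suc k) (suc n C suc k) (suc n C suc (suc k)) ⟩
  (suc k ℕ.* (suc n C suc k) ℕ.+ suc n C suc k) ℕ.+ suc (suc k) ℕ.* (suc n C suc (suc k))
    ≡⟨ cong₂ (λ a b → (a ℕ.+ suc n C suc k) ℕ.+ b) (suc[k]*[1+n]C[1+k]≡[1+n]*nCk n k) (suc[k]*[1+n]C[1+k]≡[1+n]*nCk n (suc k)) ⟩
  (suc n ℕ.* (n C k) ℕ.+ suc n C suc k) ℕ.+ suc n ℕ.* (n C suc k)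
    ≡⟨ collect (suc n) (n C k) (n C suc k) (suc n C suc k) ⟩
  suc n ℕ.* (n C k ℕ.+ n C suc k) ℕ.+ suc n C suc k
    ≡⟨ cong (λ z → suc n ℕ.* z ℕ.+ suc n C suc k) (nCk+nC[k+1]≡[n+1]C[k+1] n k) ⟩
  suc n ℕ.* (suc n C suc k) ℕ.+ suc n C suc k
    ≡⟨ ℕ.+-comm (suc n ℕ.* (suc n C suc k)) _ ⟩
  suc (suc n) ℕ.* (suc n C suc k) ∎
  where
  open ≡.≡-Reasoning
  distrib : ∀ a x y → suc a ℕ.* (x ℕ.+ y) ≡ (a ℕ.* x ℕ.+ x) ℕ.+ suc a ℕ.* y
  distrib = ℕ.solve-∀
  collect : ∀ s x y z → (s ℕ.* x ℕ.+ z) ℕ.+ s ℕ.* y ≡ s ℕ.* (x ℕ.+ y) ℕ.+ z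
  collect = ℕ.solve-∀

prime∣pCk : ∀ {p k} → Prime p → 0 < k → k < p → p ∣ p C k
prime∣pCk {suc n} {suc k} p-prime _ k<p
  with euclidsLemma (suc k) (suc n C suc k) p-prime
         (divides (n C k) (trans (suc[k]*[1+n]C[1+k]≡[1+n]*nCk n k) (ℕ.*-comm (suc n) (n C k))))
... | inj₂ p∣pCk = p∣pCk
... | inj₁ p∣k   = contradiction (ℕ.∣⇒≤ p∣k) (ℕ.<⇒≱ k<p)

[1+2q]^2≡1+2*2q*[1+q] : ∀ q → suc (2 ℕ.* q) ℕ.^ 2 ≡ suc (2 ℕ.* (2 ℕ.* q ℕ.* suc q))
[1+2q]^2≡1+2*2q*[1+q] q = trans (cong (suc (2 ℕ.* q) ℕ.*_) (ℕ.*-identityʳ (suc (2 ℕ.* q)))) (expand q)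
  where
  expand : ∀ q → suc (2 ℕ.* q) ℕ.* suc (2 ℕ.* q) ≡ suc (2 ℕ.* (2 ℕ.* q ℕ.* suc q))
  expand = ℕ.solve-∀

odd-prime : ∀ {p} → Prime p → p ≢ 2 → ∃[ q ] p ≡ suc (2 ℕ.* q)
odd-prime {p} p-prime p≢2 with p ℕ.% 2 in p%2≡r | ℕ.m%n<n p 2
... | 0           | _ with prime⇒irreducible p-prime (ℕ.m%n≡0⇒n∣m p 2 p%2≡r)
...   | inj₂ 2≡p = contradiction (sym 2≡p) p≢2
odd-prime {p} p-prime p≢2 | 1 | _ = p ℕ./ 2 , (begin
  p                      ≡⟨ ℕ.m≡m%n+[m/n]*n p 2 ⟩
  p ℕ.% 2 ℕ.+ p ℕ./ 2 ℕ.* 2 ≡⟨ cong₂ ℕ._+_ p%2≡r (ℕ.*-comm (p ℕ./ 2) 2) ⟩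
  suc (2 ℕ.* (p ℕ./ 2))  ∎)
  where open ≡.≡-Reasoning
odd-prime {p} p-prime p≢2 | suc (suc r) | s≤s (s≤s ())

prime∣2⇒≡2 : ∀ {p} → Prime p → p ∣ 2 → p ≡ 2
prime∣2⇒≡2 p-prime p∣2 with irreducible[2] p∣2
... | inj₁ refl = contradiction p-prime ¬prime[1]
... | inj₂ p≡2  = p≡2

prime^∣*⇒∣ : ∀ {p c d} k → Prime p → ¬ (p ∣ d) → p ℕ.^ k ∣ c ℕ.* d → p ℕ.^ k ∣ c
prime^∣*⇒∣ {c = c} zero p-prime p∤d _ = ℕ.1∣ c
prime^∣*⇒∣ {p} {c} {d} (suc k) p-prime p∤d p^k+1∣cd with euclidsLemma c d p-prime (ℕ.∣-trans (ℕ.m∣m*n (p ℕ.^ k)) p^k+1∣cd)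
... | inj₂ p∣d = contradiction p∣d p∤d
... | inj₁ (divides c′ refl) = subst (_∣ c′ ℕ.* p) (ℕ.*-comm (p ℕ.^ k) p) (ℕ.*-pres-∣ p^k∣c′ (ℕ.∣-refl {p}))
  where
  instance
    p≢0 : NonZero p
    p≢0 = prime⇒nonZero p-prime
  rearrange : ∀ c′ p d → c′ ℕ.* p ℕ.* d ≡ (c′ ℕ.* d) ℕ.* p
  rearrange = ℕ.solve-∀
  p^k∣c′ : p ℕ.^ k ∣ c′
  p^k∣c′ = prime^∣*⇒∣ k p-prime p∤d (ℕ.*-cancelʳ-∣ p (subst₂ _∣_ (ℕ.*-comm p (p ℕ.^ k)) (rearrange c′ p d) p^k+1∣cd))

prime∣prime^⇒≡ : ∀ {p q} k → Prime p → Prime q → p ∣ q ℕ.^ k → p ≡ q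
prime∣prime^⇒≡ zero p-prime q-prime p∣1 = contradiction (subst Prime (ℕ.∣1⇒≡1 p∣1) p-prime) ¬prime[1]
prime∣prime^⇒≡ {p} {q} (suc k) p-prime q-prime p∣q^k+1 with euclidsLemma q (q ℕ.^ k) p-prime p∣q^k+1
... | inj₂ p∣q^k = prime∣prime^⇒≡ k p-prime q-prime p∣q^k
... | inj₁ p∣q with prime⇒irreducible q-prime p∣q
...   | inj₁ refl = contradiction p-prime ¬prime[1]
...   | inj₂ p≡q  = p≡q

product∣ : ∀ {ps s} → All Prime ps → (∀ {q j} → Prime q → q ℕ.^ suc j ∣ product ps → q ℕ.^ suc j ∣ s) → product ps ∣ s
product∣ {[]}     {s} []                  _   = ℕ.1∣ s
product∣ {p ∷ ps} {s} (p-prime ∷ ps-prime) ∣s with p∣s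
  where
  p∣s : p ∣ s
  p∣s = subst (_∣ s) (ℕ.*-identityʳ p) (∣s {p} {0} p-prime (ℕ.*-pres-∣ (ℕ.∣-refl {p}) (ℕ.1∣ product ps)))
... | divides s′ refl = subst (_∣ s′ ℕ.* p) (ℕ.*-comm (product ps) p) (ℕ.*-pres-∣ (product∣ ps-prime (λ {q} {j} → ∣s′ {q} {j})) (ℕ.∣-refl {p}))
  where
  instance
    p≢0 : NonZero p
    p≢0 = prime⇒nonZero p-prime
  ∣s′ : ∀ {q j} → Prime q → q ℕ.^ suc j ∣ product ps → q ℕ.^ suc j ∣ s′
  ∣s′ {q} {j} q-prime q^j+1∣∏ with q ℕ.≟ p
  ... | yes refl = ℕ.*-cancelʳ-∣ q (subst (_∣ s′ ℕ.* q) (ℕ.*-comm q (q ℕ.^ suc j)) (∣s {q} {suc j} q-prime (ℕ.*-pres-∣ (ℕ.∣-refl {q}) q^j+1∣∏)))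
  ... | no q≢p   = prime^∣*⇒∣ (suc j) q-prime (λ q∣p → q≢p (q∣prime⇒≡ q∣p)) (∣s {q} {j} q-prime (ℕ.∣-trans q^j+1∣∏ (ℕ.n∣m*n p)))
    where
    q∣prime⇒≡ : q ∣ p → q ≡ p
    q∣prime⇒≡ q∣p = prime∣prime^⇒≡ 1 q-prime p-prime (subst (q ∣_) (sym (ℕ.*-identityʳ p)) q∣p)

∣-by-prime-powers : ∀ {n s} → .{{NonZero n}} → (∀ {p j} → Prime p → p ℕ.^ suc j ∣ n → p ℕ.^ suc j ∣ s) → n ∣ s
∣-by-prime-powers {n} {s} ∣s with factorise n
... | record { factors = ps ; isFactorisation = n≡∏ps ; factorsPrime = ps-prime } =
  subst (_∣ s) (sym n≡∏ps) (product∣ ps-prime (λ {q} {j} q-prime q^∣∏ → ∣s {q} {j} q-prime (subst (_ ∣_) (sym n≡∏ps) q^∣∏)))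

^-distribʳ-* : ∀ m n k → (m ℕ.* n) ℕ.^ k ≡ m ℕ.^ k ℕ.* n ℕ.^ k
^-distribʳ-* m n zero    = refl
^-distribʳ-* m n (suc k) = trans (cong ((m ℕ.* n) ℕ.*_) (^-distribʳ-* m n k)) (interchange m n (m ℕ.^ k) (n ℕ.^ k))
  where
  interchange : ∀ a b c d → (a ℕ.* b) ℕ.* (c ℕ.* d) ≡ (a ℕ.* c) ℕ.* (b ℕ.* d)
  interchange = ℕ.solve-∀

-- Congruences in a commutative ring

module Congruence {c ℓ} (R : CommutativeRing c ℓ) where

  open CommutativeRing R renaming (refl to ≈-refl; sym to ≈-sym; trans to ≈-trans)
  open import Algebra.Properties.Semiring.Exp semiring public using (_^_)
  open import Algebra.Properties.Semiring.Mult semiring public using (_×_)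
  open import Algebra.Properties.Semiring.Exp semiring using (^-congˡ; ^-congʳ; ^-homo-*; ^-assocʳ)
  open import Algebra.Properties.CommutativeSemiring.Exp commutativeSemiring using (^-distrib-*)
  open import Algebra.Properties.Semiring.Mult semiring using (×-congʳ; ×-homo-+; ×1-homo-*; ×-assoc-*; ×-comm-*)
  open import Algebra.Properties.Monoid.Sum +-monoid using (sum; sum-init-last)
  import Algebra.Properties.CommutativeSemiring.Binomial commutativeSemiring as Binomial
  open import Algebra.Solver.Ring.NaturalCoefficients.Default commutativeSemiring
  module ≈-Reasoning = SetoidReasoning setoid

  -- A record rather than a Σ-type, so that the modulus can be inferred from the type.
  infix 4 _≡_mod_
  record _≡_mod_ (x y m : Carrier) : Set (c ⊔ ℓ) where
    constructor congruent
    field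
      quotient : Carrier
      equality : x ≈ y + m * quotient

  private variable
    x y z x′ y′ m d k a : Carrier

  ≈⇒≡-mod : x ≈ y → x ≡ y mod m
  ≈⇒≡-mod {x} {y} {m} x≈y = congruent 0# (begin
    x           ≈⟨ x≈y ⟩
    y           ≈⟨ +-identityʳ y ⟨
    y + 0#      ≈⟨ +-congˡ (zeroʳ m) ⟨
    y + m * 0#  ∎)
    where open ≈-Reasoning

  ≡-mod-refl : x ≡ x mod m
  ≡-mod-refl = ≈⇒≡-mod ≈-refl

  ≡-mod-sym : x ≡ y mod m → y ≡ x mod m
  ≡-mod-sym {x} {y} {m} (congruent w x≈y+mw) = congruent (- w) (begin
    y                      ≈⟨ +-identityʳ y ⟨
    y + 0#                 ≈⟨ +-congˡ (zeroʳ m) ⟨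
    y + m * 0#             ≈⟨ +-congˡ (*-congˡ (-‿inverseʳ w)) ⟨
    y + m * (w - w)        ≈⟨ +-congˡ (distribˡ m w (- w)) ⟩
    y + (m * w + m * - w)  ≈⟨ +-assoc y _ _ ⟨
    (y + m * w) + m * - w  ≈⟨ +-congʳ x≈y+mw ⟨
    x + m * - w            ∎)
    where open ≈-Reasoning

  ≡-mod-trans : x ≡ y mod m → y ≡ z mod m → x ≡ z mod m
  ≡-mod-trans {x} {y} {m} {z} (congruent w x≈y+mw) (congruent v y≈z+mv) = congruent (v + w) (begin
    x                      ≈⟨ x≈y+mw ⟩
    y + m * w              ≈⟨ +-congʳ y≈z+mv ⟩
    (z + m * v) + m * w    ≈⟨ solve 4 (λ z m v w → (z :+ m :* v) :+ m :* w := z :+ m :* (v :+ w)) ≈-refl z m v w ⟩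
    z + m * (v + w)        ∎)
    where open ≈-Reasoning

  ≡-mod-isPreorder : ∀ m → IsPreorder _≈_ (_≡_mod m)
  ≡-mod-isPreorder m = record { isEquivalence = isEquivalence ; reflexive = ≈⇒≡-mod ; trans = ≡-mod-trans }

  ≡-mod-preorder : Carrier → Preorder c ℓ (c ⊔ ℓ)
  ≡-mod-preorder m = record { isPreorder = ≡-mod-isPreorder m }

  module ≡-mod-Reasoning (m : Carrier) = PreorderReasoning (≡-mod-preorder m)

  +-cong-mod : x ≡ x′ mod m → y ≡ y′ mod m → x + y ≡ x′ + y′ mod m
  +-cong-mod {x} {x′} {m} {y} {y′} (congruent w x≈) (congruent v y≈) = congruent (w + v) (begin
    x + y                          ≈⟨ +-cong x≈ y≈ ⟩
    (x′ + m * w) + (y′ + m * v)    ≈⟨ solve 5 (λ x′ y′ m w v → (x′ :+ m :* w) :+ (y′ :+ m :* v) := (x′ :+ y′) :+ m :* (w :+ v)) ≈-refl x′ y′ m w v ⟩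
    (x′ + y′) + m * (w + v)        ∎)
    where open ≈-Reasoning

  *-cong-mod : x ≡ x′ mod m → y ≡ y′ mod m → x * y ≡ x′ * y′ mod m
  *-cong-mod {x} {x′} {m} {y} {y′} (congruent w x≈) (congruent v y≈) = congruent (w * y′ + x′ * v + m * w * v) (begin
    x * y                          ≈⟨ *-cong x≈ y≈ ⟩
    (x′ + m * w) * (y′ + m * v)    ≈⟨ solve 5 (λ x′ y′ m w v → (x′ :+ m :* w) :* (y′ :+ m :* v)
                                                  := x′ :* y′ :+ m :* (w :* y′ :+ x′ :* v :+ m :* w :* v)) ≈-refl x′ y′ m w v ⟩
    x′ * y′ + m * (w * y′ + x′ * v + m * w * v) ∎)
    where open ≈-Reasoning

  ≡-mod⇒-≡0 : x ≡ y mod m → x - y ≡ 0# mod m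
  ≡-mod⇒-≡0 {x} {y} x≡y = ≡-mod-trans (+-cong-mod x≡y ≡-mod-refl) (≈⇒≡-mod (-‿inverseʳ y))

  -≡0⇒≡-mod : x - y ≡ 0# mod m → x ≡ y mod m
  -≡0⇒≡-mod {x} {y} x-y≡0 = ≡-mod-trans (≈⇒≡-mod x≈[x-y]+y) (≡-mod-trans (+-cong-mod x-y≡0 ≡-mod-refl) (≈⇒≡-mod (+-identityˡ y)))
    where
    x≈[x-y]+y : x ≈ (x - y) + y
    x≈[x-y]+y = ≈-sym (≈-trans (+-assoc x (- y) y) (≈-trans (+-congˡ (-‿inverseˡ y)) (+-identityʳ x)))

  ^-cong-mod : x ≡ y mod m → ∀ n → x ^ n ≡ y ^ n mod m
  ^-cong-mod x≡y zero    = ≡-mod-refl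
  ^-cong-mod x≡y (suc n) = *-cong-mod x≡y (^-cong-mod x≡y n)

  multiple≡0-mod : m * x ≡ 0# mod m
  multiple≡0-mod {m} {x} = congruent x (≈-sym (+-identityˡ (m * x)))

  ≈⇒≡0-mod : m ≈ d → m ≡ 0# mod d
  ≈⇒≡0-mod {m} {d} m≈d = congruent 1# (≈-trans m≈d (≈-trans (≈-sym (*-identityʳ d)) (≈-sym (+-identityˡ (d * 1#)))))

  ≡-mod-divisor : m ≡ 0# mod d → x ≡ y mod m → x ≡ y mod d
  ≡-mod-divisor {m} {d} {x} {y} (congruent v m≈) (congruent w x≈) = congruent (v * w) (begin
    x                  ≈⟨ x≈ ⟩
    y + m * w          ≈⟨ +-congˡ (*-congʳ m≈) ⟩
    y + (0# + d * v) * w ≈⟨ solve 4 (λ y d v w → y :+ (con 0 :+ d :* v) :* w := y :+ d :* (v :* w)) ≈-refl y d v w ⟩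
    y + d * (v * w)    ∎)
    where open ≈-Reasoning

  ≡-mod-*ʳ-weaken : x ≡ y mod m * k → x ≡ y mod m
  ≡-mod-*ʳ-weaken = ≡-mod-divisor multiple≡0-mod

  *-cong-mod-scaled : x ≡ y mod m → k * x ≡ k * y mod k * m
  *-cong-mod-scaled {x} {y} {m} {k} (congruent w x≈) = congruent w (begin
    k * x              ≈⟨ *-congˡ x≈ ⟩
    k * (y + m * w)    ≈⟨ solve 4 (λ k y m w → k :* (y :+ m :* w) := k :* y :+ k :* m :* w) ≈-refl k y m w ⟩
    k * y + k * m * w  ∎)
    where open ≈-Reasoning

  ≡-mod-cancel : k * a ≡ 1# mod m → a * x ≡ a * y mod m → x ≡ y mod m
  ≡-mod-cancel {k} {a} {m} {x} {y} ka≡1 ax≡ay = begin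
    x              ≈⟨ *-identityˡ x ⟨
    1# * x         ∼⟨ *-cong-mod (≡-mod-sym ka≡1) ≡-mod-refl ⟩
    (k * a) * x    ≈⟨ *-assoc k a x ⟩
    k * (a * x)    ∼⟨ *-cong-mod ≡-mod-refl ax≡ay ⟩
    k * (a * y)    ≈⟨ *-assoc k a y ⟨
    (k * a) * y    ∼⟨ *-cong-mod ka≡1 ≡-mod-refl ⟩
    1# * y         ≈⟨ *-identityˡ y ⟩
    y              ∎
    where open ≡-mod-Reasoning m

  ×≈×1#* : ∀ n x → n × x ≈ (n × 1#) * x
  ×≈×1#* n x = ≈-trans (×-congʳ n (≈-sym (*-identityˡ x))) (≈-sym (×-assoc-* n 1# x))

  ∣⇒×≡0-mod : ∀ {p n} x → p ∣ n → n × x ≡ 0# mod p × 1#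
  ∣⇒×≡0-mod {p} x (divides q refl) = congruent ((q × 1#) * x) (begin
    (q ℕ.* p) × x                     ≈⟨ ×≈×1#* (q ℕ.* p) x ⟩
    ((q ℕ.* p) × 1#) * x              ≈⟨ *-congʳ (×1-homo-* q p) ⟩
    ((q × 1#) * (p × 1#)) * x         ≈⟨ solve 3 (λ a b x → (a :* b) :* x := con 0 :+ b :* (a :* x)) ≈-refl (q × 1#) (p × 1#) x ⟩
    0# + (p × 1#) * ((q × 1#) * x)    ∎)
    where open ≈-Reasoning

  sum≡0-mod : ∀ {n} (f : Fin n → Carrier) → (∀ i → f i ≡ 0# mod m) → sum f ≡ 0# mod m
  sum≡0-mod {n = zero}  f f≡0 = ≡-mod-refl
  sum≡0-mod {n = suc n} f f≡0 = ≡-mod-trans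
    (+-cong-mod (f≡0 Fin.zero) (sum≡0-mod (λ i → f (Fin.suc i)) (λ i → f≡0 (Fin.suc i))))
    (≈⇒≡-mod (+-identityˡ 0#))

  frobenius : ∀ {p} → Prime p → ∀ x y → (x + y) ^ p ≡ x ^ p + y ^ p mod p × 1#
  frobenius {p@(suc (suc q))} p-prime x y = begin
    (x + y) ^ p                                     ≈⟨ Binomial.theorem p x y ⟩
    term Fin.zero + sum (λ i → term (Fin.suc i))    ≈⟨ +-congˡ (sum-init-last (λ i → term (Fin.suc i))) ⟩
    term Fin.zero + (sum middle + term (Fin.suc (fromℕ (suc q))))
                                                    ∼⟨ +-cong-mod ≡-mod-refl (+-cong-mod (sum≡0-mod middle middle≡0) ≡-mod-refl) ⟩
    term Fin.zero + (0# + term (Fin.suc (fromℕ (suc q))))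
                                                    ≈⟨ +-cong first≈ (≈-trans (+-identityˡ _) last≈) ⟩
    y ^ p + x ^ p                                   ≈⟨ +-comm (y ^ p) (x ^ p) ⟩
    x ^ p + y ^ p                                   ∎
    where
    open ≡-mod-Reasoning (p × 1#)
    term : Fin (suc p) → Carrier
    term = Binomial.binomialTerm x y p
    middle : Fin (suc q) → Carrier
    middle i = term (Fin.suc (inject₁ i))
    middle≡0 : ∀ i → middle i ≡ 0# mod p × 1#
    middle≡0 i = ∣⇒×≡0-mod _ (prime∣pCk p-prime (s≤s z≤n)
      (s≤s (subst (ℕ._< suc q) (sym (Fin.toℕ-inject₁ i)) (Fin.toℕ<n i))))
    first≈ : term Fin.zero ≈ y ^ p
    first≈ = ≈-trans (+-identityʳ _) (*-identityˡ (y ^ p))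
    last≈ : term (Fin.suc (fromℕ (suc q))) ≈ x ^ p
    last≈ rewrite Fin.toℕ-fromℕ q | nCn≡1 p | ℕ.n∸n≡0 q =
      ≈-trans (+-identityʳ _) (*-identityʳ (x ^ p))

  ^-p^-suc : ∀ p e x → x ^ (p ℕ.^ suc e) ≈ (x ^ p) ^ (p ℕ.^ e)
  ^-p^-suc p e x = ≈-sym (^-assocʳ x p (p ℕ.^ e))

  ^-p^-sucʳ : ∀ p e x → x ^ (p ℕ.^ suc e) ≈ (x ^ (p ℕ.^ e)) ^ p
  ^-p^-sucʳ p e x = ≈-trans (^-congʳ x (ℕ.*-comm p (p ℕ.^ e))) (≈-sym (^-assocʳ x (p ℕ.^ e) p))

  ^-p^-+ : ∀ p a b x → (x ^ (p ℕ.^ a)) ^ (p ℕ.^ b) ≈ x ^ (p ℕ.^ (a ℕ.+ b))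
  ^-p^-+ p a b x = ≈-trans (^-assocʳ x (p ℕ.^ a) (p ℕ.^ b)) (^-congʳ x (sym (ℕ.^-distribˡ-+-* p a b)))

  frobenius-iterate : ∀ {p} → Prime p → ∀ e x y → (x + y) ^ (p ℕ.^ e) ≡ x ^ (p ℕ.^ e) + y ^ (p ℕ.^ e) mod p × 1#
  frobenius-iterate {p} p-prime zero    x y = ≈⇒≡-mod (distribʳ 1# x y)
  frobenius-iterate {p} p-prime (suc e) x y = begin
    (x + y) ^ (p ℕ.^ suc e)                   ≈⟨ ^-p^-suc p e (x + y) ⟩
    ((x + y) ^ p) ^ (p ℕ.^ e)                 ∼⟨ ^-cong-mod (frobenius p-prime x y) (p ℕ.^ e) ⟩
    (x ^ p + y ^ p) ^ (p ℕ.^ e)               ∼⟨ frobenius-iterate p-prime e (x ^ p) (y ^ p) ⟩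
    (x ^ p) ^ (p ℕ.^ e) + (y ^ p) ^ (p ℕ.^ e)   ≈⟨ +-cong (^-p^-suc p e x) (^-p^-suc p e y) ⟨
    x ^ (p ℕ.^ suc e) + y ^ (p ℕ.^ suc e)       ∎
    where open ≡-mod-Reasoning (p × 1#)

  fermat-iterate : ∀ p e → x ^ p ≡ x mod m → x ^ (p ℕ.^ e) ≡ x mod m
  fermat-iterate {x} p zero    x^p≡x = ≈⇒≡-mod (*-identityʳ x)
  fermat-iterate {x} p (suc e) x^p≡x = ≡-mod-trans (≈⇒≡-mod (^-p^-suc p e x))
    (≡-mod-trans (^-cong-mod x^p≡x (p ℕ.^ e)) (fermat-iterate p e x^p≡x))

  1#^n≈1# : ∀ n → 1# ^ n ≈ 1#
  1#^n≈1# zero    = ≈-refl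
  1#^n≈1# (suc n) = ≈-trans (*-identityˡ (1# ^ n)) (1#^n≈1# n)

  ^-≡0-mod : x ≡ 0# mod m → ∀ n → .{{ℕ.NonZero n}} → x ^ n ≡ 0# mod m
  ^-≡0-mod {x} x≡0 (suc n) = ≡-mod-trans (*-cong-mod x≡0 ≡-mod-refl) (≈⇒≡-mod (zeroˡ (x ^ n)))

  fermat-× : ∀ {p} → Prime p → ∀ n → (n × 1#) ^ p ≡ n × 1# mod p × 1#
  fermat-× {suc k} p-prime zero    = ≈⇒≡-mod (zeroˡ (0# ^ k))
  fermat-× {p}     p-prime (suc n) = begin
    (1# + n × 1#) ^ p          ∼⟨ frobenius p-prime 1# (n × 1#) ⟩
    1# ^ p + (n × 1#) ^ p      ∼⟨ +-cong-mod (≈⇒≡-mod (1#^n≈1# p)) (fermat-× p-prime n) ⟩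
    1# + n × 1#                ∎
    where open ≡-mod-Reasoning (p × 1#)

  fermat-‿ : ∀ {p} → Prime p → x ^ p ≡ x mod p × 1# → (- x) ^ p ≡ - x mod p × 1#
  fermat-‿ {x} {p@(suc k)} p-prime x^p≡x = begin
    (- x) ^ p                  ≈⟨ cancel (- x) x ((- x) ^ p) (-‿inverseˡ x) ⟨
    - x + (x + (- x) ^ p)      ∼⟨ +-cong-mod ≡-mod-refl x+[-x]^p≡0 ⟩
    - x + 0#                   ≈⟨ +-identityʳ (- x) ⟩
    - x                        ∎
    where
    open ≡-mod-Reasoning (p × 1#)
    cancel : ∀ a b c → a + b ≈ 0# → a + (b + c) ≈ c
    cancel a b c a+b≈0 = ≈-trans (≈-sym (+-assoc a b c)) (≈-trans (+-congʳ a+b≈0) (+-identityˡ c))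
    x+[-x]^p≡0 : x + (- x) ^ p ≡ 0# mod p × 1#
    x+[-x]^p≡0 = begin
      x + (- x) ^ p        ∼⟨ +-cong-mod (≡-mod-sym x^p≡x) ≡-mod-refl ⟩
      x ^ p + (- x) ^ p    ∼⟨ ≡-mod-sym (frobenius p-prime x (- x)) ⟩
      (x + - x) ^ p        ≈⟨ ^-congˡ p (-‿inverseʳ x) ⟩
      0# ^ p               ≈⟨ zeroˡ (0# ^ k) ⟩
      0#                   ∎

  -- q + 1 is an inverse of 2 modulo p = 2q + 1.
  two-cancel-mod : ∀ {p q} → p ≡ suc (2 ℕ.* q) → (2 × 1#) * x ≡ (2 × 1#) * y mod p × 1# → x ≡ y mod p × 1#
  two-cancel-mod {x} {y} {p} {q} p≡1+2q = ≡-mod-cancel (begin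
    (suc q × 1#) * (2 × 1#)      ≈⟨ ×1-homo-* (suc q) 2 ⟨
    (suc q ℕ.* 2) × 1#           ≡⟨ cong (_× 1#) (trans (double q) (cong suc (sym p≡1+2q))) ⟩
    (1 ℕ.+ p) × 1#               ≈⟨ ×-homo-+ 1# 1 p ⟩
    1 × 1# + p × 1#              ∼⟨ +-cong-mod ≡-mod-refl (≈⇒≡0-mod ≈-refl) ⟩
    1 × 1# + 0#                  ≈⟨ +-identityʳ _ ⟩
    1# + 0#                      ≈⟨ +-identityʳ 1# ⟩
    1#                           ∎)
    where
    open ≡-mod-Reasoning (p × 1#)
    double : ∀ q → suc q ℕ.* 2 ≡ suc (suc (2 ℕ.* q))
    double = ℕ.solve-∀

  halve-^ : ∀ {p q} → Prime p → p ≡ suc (2 ℕ.* q) → ∀ e →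
            ((2 × 1#) * x) ^ (p ℕ.^ e) ≡ (2 × 1#) * y mod p × 1# → x ^ (p ℕ.^ e) ≡ y mod p × 1#
  halve-^ {x} {y} {p} {q} p-prime p≡1+2q e [2x]^≡2y = two-cancel-mod {q = q} p≡1+2q (begin
    (2 × 1#) * x ^ (p ℕ.^ e)                ∼⟨ *-cong-mod (≡-mod-sym (fermat-iterate p e (fermat-× p-prime 2))) ≡-mod-refl ⟩
    (2 × 1#) ^ (p ℕ.^ e) * x ^ (p ℕ.^ e)    ≈⟨ ^-distrib-* (2 × 1#) x (p ℕ.^ e) ⟨
    ((2 × 1#) * x) ^ (p ℕ.^ e)              ∼⟨ [2x]^≡2y ⟩
    (2 × 1#) * y                            ∎)
    where open ≡-mod-Reasoning (p × 1#)

  geometric : Carrier → Carrier → ℕ → Carrier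
  geometric x y zero    = 0#
  geometric x y (suc n) = x ^ n + y * geometric x y n

  ^-≈-geometric : x ≈ y + d → ∀ n → x ^ n ≈ y ^ n + d * geometric x y n
  ^-≈-geometric {x} {y} {d} x≈y+d zero    = ≈-sym (≈-trans (+-congˡ (zeroʳ d)) (+-identityʳ 1#))
  ^-≈-geometric {x} {y} {d} x≈y+d (suc n) = begin
    x * x ^ n                         ≈⟨ *-cong x≈y+d IH ⟩
    (y + d) * (y ^ n + d * G)         ≈⟨ solve 4 (λ y d Y G → (y :+ d) :* (Y :+ d :* G) := y :* Y :+ d :* ((Y :+ d :* G) :+ y :* G)) ≈-refl y d (y ^ n) G ⟩
    y * y ^ n + d * ((y ^ n + d * G) + y * G) ≈⟨ +-congˡ (*-congˡ (+-congʳ IH)) ⟨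
    y * y ^ n + d * (x ^ n + y * G)   ∎
    where
    open ≈-Reasoning
    G : Carrier
    G = geometric x y n
    IH : x ^ n ≈ y ^ n + d * G
    IH = ^-≈-geometric x≈y+d n

  geometric-diagonal : x ≡ y mod m → ∀ n → geometric x y (suc n) ≡ suc n × y ^ n mod m
  geometric-diagonal {x} {y} x≡y zero    = ≈⇒≡-mod (+-congˡ (zeroʳ y))
  geometric-diagonal {x} {y} x≡y (suc n) = ≡-mod-trans
    (+-cong-mod (^-cong-mod x≡y (suc n)) (*-cong-mod ≡-mod-refl (geometric-diagonal x≡y n)))
    (≈⇒≡-mod (+-congˡ (×-comm-* (suc n) y (y ^ n))))

  -- xᵖ − yᵖ = (x − y) · geometric x y p, and geometric x y p ≡ p yᵖ⁻¹ ≡ 0 modulo P.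
  ^-lift : ∀ p {P} → p × 1# ≡ 0# mod P → x ≡ y mod P * m → x ^ p ≡ y ^ p mod P * (P * m)
  ^-lift zero    P∣p x≡y = ≡-mod-refl
  ^-lift {x} {y} {m} (suc q) {P} P∣p x≡y@(congruent w x≈y+Pmw) = congruent (w * g) (begin
    x ^ suc q                                  ≈⟨ ^-≈-geometric x≈y+Pmw (suc q) ⟩
    y ^ suc q + ((P * m) * w) * G              ≈⟨ +-congˡ (*-congˡ G≈Pg) ⟩
    y ^ suc q + ((P * m) * w) * (0# + P * g)   ≈⟨ solve 5 (λ Y P m w g → Y :+ ((P :* m) :* w) :* (con 0 :+ P :* g)
                                                               := Y :+ (P :* (P :* m)) :* (w :* g)) ≈-refl (y ^ suc q) P m w g ⟩
    y ^ suc q + (P * (P * m)) * (w * g)        ∎)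
    where
    open ≈-Reasoning
    G : Carrier
    G = geometric x y (suc q)
    G≡0 : G ≡ 0# mod P
    G≡0 = ≡-mod-trans (≡-mod-*ʳ-weaken (geometric-diagonal x≡y q))
            (≡-mod-trans (≈⇒≡-mod (×≈×1#* (suc q) (y ^ q)))
              (≡-mod-trans (*-cong-mod P∣p ≡-mod-refl) (≈⇒≡-mod (zeroˡ (y ^ q)))))
    open _≡_mod_ G≡0 renaming (quotient to g; equality to G≈Pg)

  ≡-mod-^-weaken : ∀ {i j} → i ≤ j → x ≡ y mod m ^ j → x ≡ y mod m ^ i
  ≡-mod-^-weaken {m = m} {i} {j} i≤j = ≡-mod-divisor (≡-mod-trans
    (≈⇒≡-mod (≈-trans (^-congʳ m (sym (ℕ.m+[n∸m]≡n i≤j))) (^-homo-* m i (j ℕ.∸ i)))) multiple≡0-mod)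

  module _ (p : ℕ) {P : Carrier} (P∣p : p × 1# ≡ 0# mod P) where

    periodic-lift : ∀ e → x ^ (p ℕ.^ e) ≡ x mod P → ∀ s → x ^ (p ℕ.^ (e ℕ.+ s)) ≡ x ^ (p ℕ.^ s) mod P ^ suc s
    periodic-lift {x} e x^p^e≡x zero = begin
      x ^ (p ℕ.^ (e ℕ.+ 0))   ≈⟨ ^-congʳ x (cong (p ℕ.^_) (ℕ.+-identityʳ e)) ⟩
      x ^ (p ℕ.^ e)           ∼⟨ ≡-mod-divisor (≈⇒≡0-mod (≈-sym (*-identityʳ P))) x^p^e≡x ⟩
      x                       ≈⟨ *-identityʳ x ⟨
      x ^ 1                   ∎
      where open ≡-mod-Reasoning (P ^ 1)
    periodic-lift {x} e x^p^e≡x (suc s) = begin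
      x ^ (p ℕ.^ (e ℕ.+ suc s))     ≈⟨ ^-congʳ x (cong (p ℕ.^_) (ℕ.+-suc e s)) ⟩
      x ^ (p ℕ.^ suc (e ℕ.+ s))     ≈⟨ ^-p^-sucʳ p (e ℕ.+ s) x ⟩
      (x ^ (p ℕ.^ (e ℕ.+ s))) ^ p   ∼⟨ ^-lift p P∣p (periodic-lift e x^p^e≡x s) ⟩
      (x ^ (p ℕ.^ s)) ^ p           ≈⟨ ^-p^-sucʳ p s x ⟨
      x ^ (p ℕ.^ suc s)             ∎
      where open ≡-mod-Reasoning (P ^ suc (suc s))

    periodic-lift-iterate : ∀ e → x ^ (p ℕ.^ e) ≡ x mod P → ∀ T s → x ^ (p ℕ.^ (T ℕ.* e ℕ.+ s)) ≡ x ^ (p ℕ.^ s) mod P ^ suc s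
    periodic-lift-iterate e x^p^e≡x zero    s = ≡-mod-refl
    periodic-lift-iterate {x} e x^p^e≡x (suc T) s = begin
      x ^ (p ℕ.^ ((e ℕ.+ T ℕ.* e) ℕ.+ s))   ≈⟨ ^-congʳ x (cong (p ℕ.^_) (ℕ.+-assoc e (T ℕ.* e) s)) ⟩
      x ^ (p ℕ.^ (e ℕ.+ (T ℕ.* e ℕ.+ s)))   ∼⟨ ≡-mod-^-weaken (s≤s (ℕ.m≤n+m s (T ℕ.* e))) (periodic-lift e x^p^e≡x (T ℕ.* e ℕ.+ s)) ⟩
      x ^ (p ℕ.^ (T ℕ.* e ℕ.+ s))           ∼⟨ periodic-lift-iterate e x^p^e≡x T s ⟩
      x ^ (p ℕ.^ s)                         ∎
      where open ≡-mod-Reasoning (P ^ suc s)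

-- Integers

module IntegerCongruence where

  open import Data.Integer using (_+_; _*_; -_; _-_)
  open Congruence ℤ.+-*-commutativeRing public

  n×1≡+n : ∀ n → n × + 1 ≡ + n
  n×1≡+n zero    = refl
  n×1≡+n (suc n) = cong (λ z → + 1 + z) (n×1≡+n n)

  pos-^ : ∀ m n → (+ m) ^ n ≡ + (m ℕ.^ n)
  pos-^ m zero    = refl
  pos-^ m (suc n) = trans (cong (+ m *_) (pos-^ m n)) (sym (ℤ.pos-* m (m ℕ.^ n)))

  ≡0-mod⇒∣ : ∀ {x n} → x ≡ + 0 mod + n → n ∣ ℤ.∣ x ∣
  ≡0-mod⇒∣ {x} {n} (congruent w x≡nw) = ℕ.divides ℤ.∣ w ∣ (begin
    ℤ.∣ x ∣              ≡⟨ cong ℤ.∣_∣ (trans x≡nw (ℤ.+-identityˡ (+ n * w))) ⟩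
    ℤ.∣ + n * w ∣        ≡⟨ ℤ.abs-* (+ n) w ⟩
    n ℕ.* ℤ.∣ w ∣        ≡⟨ ℕ.*-comm n ℤ.∣ w ∣ ⟩
    ℤ.∣ w ∣ ℕ.* n        ∎)
    where open ≡.≡-Reasoning

  ∣⇒≡0-mod : ∀ {x n} → n ∣ ℤ.∣ x ∣ → x ≡ + 0 mod + n
  ∣⇒≡0-mod {x} {n} n∣x = from-signed (Signed.∣ᵤ⇒∣ n∣x)
    where
    from-signed : + n Signed.∣ x → x ≡ + 0 mod + n
    from-signed (Signed.divides q x≡qn) = congruent q (trans x≡qn (trans (ℤ.*-comm q (+ n)) (sym (ℤ.+-identityˡ (+ n * q)))))

  fermat : ∀ {p} → Prime p → ∀ a → a ^ p ≡ a mod + p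
  fermat {p} p-prime a = subst (a ^ p ≡ a mod_) (n×1≡+n p) (fermat-×1 a)
    where
    fermat-×1 : ∀ a → a ^ p ≡ a mod p × + 1
    fermat-×1 (+ n)    = subst (λ a → a ^ p ≡ a mod p × + 1) (n×1≡+n n) (fermat-× p-prime n)
    fermat-×1 -[1+ n ] = fermat-‿ p-prime (fermat-×1 (+ suc n))

  euclid-mod : ∀ {p} → Prime p → ∀ a b → a * b ≡ + 0 mod + p → a ≡ + 0 mod + p ⊎ b ≡ + 0 mod + p
  euclid-mod p-prime a b ab≡0 = Sum.map ∣⇒≡0-mod ∣⇒≡0-mod
    (euclidsLemma ℤ.∣ a ∣ ℤ.∣ b ∣ p-prime (subst (_ ∣_) (ℤ.abs-* a b) (≡0-mod⇒∣ ab≡0)))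

  private
    factor : ∀ a b → a * (b - + 1) ≡ a * b - a
    factor = solve-∀

  fermat-unit : ∀ {k} → Prime (suc k) → ∀ a → ¬ (a ≡ + 0 mod + suc k) → a ^ k ≡ + 1 mod + suc k
  fermat-unit {k} p-prime a a≢0 =
    [ (λ a≡0 → contradiction a≡0 a≢0) , -≡0⇒≡-mod ]′ (euclid-mod p-prime a (a ^ k - + 1) a[a^k-1]≡0)
    where
    a[a^k-1]≡0 : a * (a ^ k - + 1) ≡ + 0 mod + suc k
    a[a^k-1]≡0 = subst (_≡ + 0 mod + suc k) (sym (factor a (a ^ k))) (≡-mod⇒-≡0 (fermat p-prime a))

  ≡-mod-one : ∀ x y → x ≡ y mod + 1
  ≡-mod-one x y = congruent (x - y) (x≡y+[x-y] x y)
    where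
    x≡y+[x-y] : ∀ x y → x ≡ y + + 1 * (x - y)
    x≡y+[x-y] = solve-∀

  *-cong-mod-multiple : ∀ {p c k x y} → p ∣ c → x ≡ y mod + (p ℕ.^ k) → + c * x ≡ + c * y mod + (p ℕ.^ suc k)
  *-cong-mod-multiple {p} {c} {k} p∣c x≡y =
    ≡-mod-divisor (subst (_≡ + 0 mod + (p ℕ.^ suc k)) (ℤ.pos-* c (p ℕ.^ k)) (∣⇒≡0-mod (ℕ.*-pres-∣ p∣c (ℕ.∣-refl {p ℕ.^ k}))))
      (*-cong-mod-scaled {k = + c} x≡y)

-- The quadratic ring ℤ[ξ]

module QuadraticInteger (r₁ r₂ : ℤ) where

  open import Data.Integer using (_+_; _*_; -_)
  private
    module ℤ-mod = IntegerCongruence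

  -- ⟨ a , b ⟩ is a + bξ, where ξ² = r₁ξ + r₂. A data type rather than a pair: a product with an
  -- unknown factor then does not reduce, which keeps unification cheap.
  data ℤ[ξ] : Set where
    ⟨_,_⟩ : ℤ → ℤ → ℤ[ξ]

  infixl 6 _⊕_
  infixl 7 _⊗_
  _⊕_ _⊗_ : ℤ[ξ] → ℤ[ξ] → ℤ[ξ]
  ⟨ a , b ⟩ ⊕ ⟨ c , d ⟩ = ⟨ a + c , b + d ⟩
  ⟨ a , b ⟩ ⊗ ⟨ c , d ⟩ = ⟨ a * c + r₂ * (b * d) , a * d + b * c + r₁ * (b * d) ⟩

  ⊖_ : ℤ[ξ] → ℤ[ξ]
  ⊖ ⟨ a , b ⟩ = ⟨ - a , - b ⟩

  embed : ℤ → ℤ[ξ]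
  embed a = ⟨ a , + 0 ⟩

  0ξ 1ξ : ℤ[ξ]
  0ξ = embed (+ 0)
  1ξ = embed (+ 1)

  private
    *-assoc₁ : ∀ r₁ r₂ a b c d e f → (a * c + r₂ * (b * d)) * e + r₂ * ((a * d + b * c + r₁ * (b * d)) * f)
                                   ≡ a * (c * e + r₂ * (d * f)) + r₂ * (b * (c * f + d * e + r₁ * (d * f)))
    *-assoc₁ = solve-∀
    *-assoc₂ : ∀ r₁ r₂ a b c d e f → (a * c + r₂ * (b * d)) * f + (a * d + b * c + r₁ * (b * d)) * e + r₁ * ((a * d + b * c + r₁ * (b * d)) * f)
                                   ≡ a * (c * f + d * e + r₁ * (d * f)) + b * (c * e + r₂ * (d * f)) + r₁ * (b * (c * f + d * e + r₁ * (d * f)))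
    *-assoc₂ = solve-∀
    *-comm₁ : ∀ r₂ a b c d → a * c + r₂ * (b * d) ≡ c * a + r₂ * (d * b)
    *-comm₁ = solve-∀
    *-comm₂ : ∀ r₁ a b c d → a * d + b * c + r₁ * (b * d) ≡ c * b + d * a + r₁ * (d * b)
    *-comm₂ = solve-∀
    *-identityˡ₁ : ∀ r₂ a b → + 1 * a + r₂ * (+ 0 * b) ≡ a
    *-identityˡ₁ = solve-∀
    *-identityˡ₂ : ∀ r₁ a b → + 1 * b + + 0 * a + r₁ * (+ 0 * b) ≡ b
    *-identityˡ₂ = solve-∀
    distribʳ₁ : ∀ r₂ a b c d e f → (c + e) * a + r₂ * ((d + f) * b) ≡ (c * a + r₂ * (d * b)) + (e * a + r₂ * (f * b))
    distribʳ₁ = solve-∀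
    distribʳ₂ : ∀ r₁ a b c d e f → (c + e) * b + (d + f) * a + r₁ * ((d + f) * b) ≡ (c * b + d * a + r₁ * (d * b)) + (e * b + f * a + r₁ * (f * b))
    distribʳ₂ = solve-∀

  ⊗-assoc : ∀ x y z → (x ⊗ y) ⊗ z ≡ x ⊗ (y ⊗ z)
  ⊗-assoc ⟨ a , b ⟩ ⟨ c , d ⟩ ⟨ e , f ⟩ = cong₂ ⟨_,_⟩ (*-assoc₁ r₁ r₂ a b c d e f) (*-assoc₂ r₁ r₂ a b c d e f)

  ⊗-comm : ∀ x y → x ⊗ y ≡ y ⊗ x
  ⊗-comm ⟨ a , b ⟩ ⟨ c , d ⟩ = cong₂ ⟨_,_⟩ (*-comm₁ r₂ a b c d) (*-comm₂ r₁ a b c d)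

  ⊗-identityˡ : ∀ x → 1ξ ⊗ x ≡ x
  ⊗-identityˡ ⟨ a , b ⟩ = cong₂ ⟨_,_⟩ (*-identityˡ₁ r₂ a b) (*-identityˡ₂ r₁ a b)

  ⊗-distribʳ : ∀ x y z → (y ⊕ z) ⊗ x ≡ y ⊗ x ⊕ z ⊗ x
  ⊗-distribʳ ⟨ a , b ⟩ ⟨ c , d ⟩ ⟨ e , f ⟩ = cong₂ ⟨_,_⟩ (distribʳ₁ r₂ a b c d e f) (distribʳ₂ r₁ a b c d e f)

  isCommutativeRing : IsCommutativeRing _≡_ _⊕_ _⊗_ ⊖_ (0ξ) (1ξ)
  isCommutativeRing = record
    { isRing = record
      { +-isAbelianGroup = record
        { isGroup = record
          { isMonoid = record
            { isSemigroup = record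
              { isMagma = record { isEquivalence = ≡.isEquivalence ; ∙-cong = cong₂ _⊕_ }
              ; assoc = λ { ⟨ a , b ⟩ ⟨ c , d ⟩ ⟨ e , f ⟩ → cong₂ ⟨_,_⟩ (ℤ.+-assoc a c e) (ℤ.+-assoc b d f) } }
            ; identity = (λ { ⟨ a , b ⟩ → cong₂ ⟨_,_⟩ (ℤ.+-identityˡ a) (ℤ.+-identityˡ b) })
                       , (λ { ⟨ a , b ⟩ → cong₂ ⟨_,_⟩ (ℤ.+-identityʳ a) (ℤ.+-identityʳ b) }) }
          ; inverse = (λ { ⟨ a , b ⟩ → cong₂ ⟨_,_⟩ (ℤ.+-inverseˡ a) (ℤ.+-inverseˡ b) })
                    , (λ { ⟨ a , b ⟩ → cong₂ ⟨_,_⟩ (ℤ.+-inverseʳ a) (ℤ.+-inverseʳ b) })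
          ; ⁻¹-cong = cong ⊖_ }
        ; comm = λ { ⟨ a , b ⟩ ⟨ c , d ⟩ → cong₂ ⟨_,_⟩ (ℤ.+-comm a c) (ℤ.+-comm b d) } }
      ; *-cong = cong₂ _⊗_
      ; *-assoc = ⊗-assoc
      ; *-identity = ⊗-identityˡ , λ x → trans (⊗-comm x _) (⊗-identityˡ x)
      ; distrib = (λ x y z → trans (⊗-comm x (y ⊕ z)) (trans (⊗-distribʳ x y z) (cong₂ _⊕_ (⊗-comm y x) (⊗-comm z x))))
                , ⊗-distribʳ }
    ; *-comm = ⊗-comm }

  commutativeRing : CommutativeRing 0ℓ 0ℓ
  commutativeRing = record { isCommutativeRing = isCommutativeRing }

  open Congruence commutativeRing public

  private
    module R = CommutativeRing commutativeRing
  open import Algebra.Properties.Semiring.Exp R.semiring using (^-assocʳ)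
  open import Algebra.Properties.CommutativeSemiring.Exp R.commutativeSemiring using (^-distrib-*)

  ξ : ℤ[ξ]
  ξ = ⟨ + 0 , + 1 ⟩

  -- 2ξ − r₁, a square root of the discriminant D
  δ : ℤ[ξ]
  δ = ⟨ - r₁ , + 2 ⟩

  D : ℤ
  D = r₁ * r₁ + + 4 * r₂

  private
    ξ-squared₁ : ∀ r₁ r₂ → + 0 * + 0 + r₂ * (+ 1 * + 1) ≡ (r₁ * + 0 + r₂ * (+ 0 * + 1)) + r₂
    ξ-squared₁ = solve-∀
    ξ-squared₂ : ∀ r₁ → + 0 * + 1 + + 1 * + 0 + r₁ * (+ 1 * + 1) ≡ (r₁ * + 1 + + 0 * + 0 + r₁ * (+ 0 * + 1)) + + 0
    ξ-squared₂ = solve-∀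
    two-ξ₁ : ∀ r₁ r₂ → + 2 * + 0 + r₂ * (+ 0 * + 1) ≡ r₁ + - r₁
    two-ξ₁ = solve-∀
    two-ξ₂ : ∀ r₁ → + 2 * + 1 + + 0 * + 0 + r₁ * (+ 0 * + 1) ≡ + 0 + + 2
    two-ξ₂ = solve-∀
    δ-squared₁ : ∀ r₁ r₂ → - r₁ * - r₁ + r₂ * (+ 2 * + 2) ≡ r₁ * r₁ + + 4 * r₂
    δ-squared₁ = solve-∀
    δ-squared₂ : ∀ r₁ → - r₁ * + 2 + + 2 * - r₁ + r₁ * (+ 2 * + 2) ≡ + 0
    δ-squared₂ = solve-∀
    embed-⊗₁ : ∀ r₂ a b → a * b ≡ a * b + r₂ * (+ 0 * + 0)
    embed-⊗₁ = solve-∀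
    embed-⊗₂ : ∀ r₁ a b → + 0 ≡ a * + 0 + + 0 * b + r₁ * (+ 0 * + 0)
    embed-⊗₂ = solve-∀

  ξ-squared : ξ ⊗ ξ ≡ embed r₁ ⊗ ξ ⊕ embed r₂
  ξ-squared = cong₂ ⟨_,_⟩ (ξ-squared₁ r₁ r₂) (ξ-squared₂ r₁)

  two-ξ : (2 × 1ξ) ⊗ ξ ≡ embed r₁ ⊕ δ
  two-ξ = cong₂ ⟨_,_⟩ (two-ξ₁ r₁ r₂) (two-ξ₂ r₁)

  δ-squared : δ ⊗ δ ≡ embed D
  δ-squared = cong₂ ⟨_,_⟩ (δ-squared₁ r₁ r₂) (δ-squared₂ r₁)

  embed-⊗ : ∀ a b → embed (a * b) ≡ embed a ⊗ embed b
  embed-⊗ a b = cong₂ ⟨_,_⟩ (embed-⊗₁ r₂ a b) (embed-⊗₂ r₁ a b)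

  embed-^ : ∀ a n → embed (a ℤ-mod.^ n) ≡ embed a ^ n
  embed-^ a zero    = refl
  embed-^ a (suc n) = trans (embed-⊗ a (a ℤ-mod.^ n)) (cong (embed a ⊗_) (embed-^ a n))

  n×1≡embed : ∀ n → n × 1ξ ≡ embed (+ n)
  n×1≡embed zero    = refl
  n×1≡embed (suc n) = cong (1ξ ⊕_) (n×1≡embed n)

  embed-mod : ∀ {a b p} → a ℤ-mod.≡ b mod + p → embed a ≡ embed b mod p × 1ξ
  embed-mod {a} {b} {p} (ℤ-mod.congruent w a≡b+pw) = congruent (embed w) (begin
    embed a                           ≡⟨ cong embed a≡b+pw ⟩
    embed b ⊕ embed (+ p * w)         ≡⟨ cong (embed b ⊕_) (embed-⊗ (+ p) w) ⟩
    embed b ⊕ embed (+ p) ⊗ embed w   ≡⟨ cong (λ P → embed b ⊕ P ⊗ embed w) (n×1≡embed p) ⟨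
    embed b ⊕ (p × 1ξ) ⊗ embed w ∎)
    where open ≡.≡-Reasoning

  fermat-embed : ∀ {p} → Prime p → ∀ a → embed a ^ p ≡ embed a mod p × 1ξ
  fermat-embed {p} p-prime a = subst (_≡ embed a mod p × 1ξ) (embed-^ a p) (embed-mod (ℤ-mod.fermat p-prime a))

  δ^odd : ∀ k → δ ^ suc (2 ℕ.* k) ≡ δ ⊗ embed D ^ k
  δ^odd k = cong (δ ⊗_) (begin
    δ ^ (2 ℕ.* k)     ≡⟨ ^-assocʳ δ 2 k ⟨
    (δ ^ 2) ^ k       ≡⟨ cong (λ x → (δ ⊗ x) ^ k) (R.*-identityʳ δ) ⟩
    (δ ⊗ δ) ^ k       ≡⟨ cong (_^ k) δ-squared ⟩
    embed D ^ k       ∎)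
    where open ≡.≡-Reasoning

  -- Frobenius fixes r₁ and sends δ to δ · D^((p²−1)/2), which is δ if p ∤ D and 0 if p ∣ D.
  module OddPrime {p q : ℕ} (p-prime : Prime p) (p≡1+2q : p ≡ suc (2 ℕ.* q)) where

    private
      E : ℤ[ξ]
      E = embed D ^ (2 ℕ.* q)

      [2ξ]^p² : ((2 × 1ξ) ⊗ ξ) ^ (p ℕ.^ 2) ≡ embed r₁ ⊕ δ ⊗ E ^ suc q mod p × 1ξ
      [2ξ]^p² = begin
        ((2 × 1ξ) ⊗ ξ) ^ (p ℕ.^ 2)             ≡⟨ cong (_^ (p ℕ.^ 2)) two-ξ ⟩
        (embed r₁ ⊕ δ) ^ (p ℕ.^ 2)              ∼⟨ frobenius-iterate p-prime 2 (embed r₁) δ ⟩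
        embed r₁ ^ (p ℕ.^ 2) ⊕ δ ^ (p ℕ.^ 2)    ∼⟨ +-cong-mod (fermat-iterate p 2 (fermat-embed p-prime r₁)) ≡-mod-refl ⟩
        embed r₁ ⊕ δ ^ (p ℕ.^ 2)                ≡⟨ cong (λ n → embed r₁ ⊕ δ ^ n) (trans (cong (ℕ._^ 2) p≡1+2q) ([1+2q]^2≡1+2*2q*[1+q] q)) ⟩
        embed r₁ ⊕ δ ^ suc (2 ℕ.* (2 ℕ.* q ℕ.* suc q)) ≡⟨ cong (embed r₁ ⊕_) (δ^odd (2 ℕ.* q ℕ.* suc q)) ⟩
        embed r₁ ⊕ δ ⊗ embed D ^ (2 ℕ.* q ℕ.* suc q)   ≡⟨ cong (λ x → embed r₁ ⊕ δ ⊗ x) (^-assocʳ (embed D) (2 ℕ.* q) (suc q)) ⟨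
        embed r₁ ⊕ δ ⊗ E ^ suc q                ∎
        where open ≡-mod-Reasoning (p × 1ξ)

    unramified : ¬ (p ∣ ℤ.∣ D ∣) → ξ ^ (p ℕ.^ 2) ≡ ξ mod p × 1ξ
    unramified p∤D = halve-^ {q = q} p-prime p≡1+2q 2 (begin
      ((2 × 1ξ) ⊗ ξ) ^ (p ℕ.^ 2)    ∼⟨ [2ξ]^p² ⟩
      embed r₁ ⊕ δ ⊗ E ^ suc q       ∼⟨ +-cong-mod ≡-mod-refl (*-cong-mod ≡-mod-refl (^-cong-mod E≡1 (suc q))) ⟩
      embed r₁ ⊕ δ ⊗ 1ξ ^ suc q      ≡⟨ cong (λ x → embed r₁ ⊕ δ ⊗ x) (1#^n≈1# (suc q)) ⟩
      embed r₁ ⊕ δ ⊗ 1ξ              ≡⟨ cong (embed r₁ ⊕_) (R.*-identityʳ δ) ⟩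
      embed r₁ ⊕ δ                   ≡⟨ two-ξ ⟨
      (2 × 1ξ) ⊗ ξ                   ∎)
      where
      open ≡-mod-Reasoning (p × 1ξ)
      D≢0 : ¬ (D ℤ-mod.≡ + 0 mod + suc (2 ℕ.* q))
      D≢0 D≡0 = p∤D (subst (_∣ ℤ.∣ D ∣) (sym p≡1+2q) (ℤ-mod.≡0-mod⇒∣ D≡0))
      D^2q≡1 : D ℤ-mod.^ (2 ℕ.* q) ℤ-mod.≡ + 1 mod + p
      D^2q≡1 = subst (λ n → D ℤ-mod.^ (2 ℕ.* q) ℤ-mod.≡ + 1 mod + n) (sym p≡1+2q)
                 (ℤ-mod.fermat-unit (subst Prime p≡1+2q p-prime) D D≢0)
      E≡1 : E ≡ 1ξ mod p × 1ξ
      E≡1 = subst (_≡ 1ξ mod p × 1ξ) (embed-^ D (2 ℕ.* q)) (embed-mod D^2q≡1)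

    ramified : p ∣ ℤ.∣ D ∣ → ξ ^ (p ℕ.^ 4) ≡ ξ ^ (p ℕ.^ 2) mod p × 1ξ
    ramified p∣D = halve-^ {q = q} p-prime p≡1+2q 4 (begin
      ((2 × 1ξ) ⊗ ξ) ^ (p ℕ.^ 4)                   ≡⟨ ^-p^-+ p 2 2 ((2 × 1ξ) ⊗ ξ) ⟨
      (((2 × 1ξ) ⊗ ξ) ^ (p ℕ.^ 2)) ^ (p ℕ.^ 2)     ∼⟨ ^-cong-mod [2ξ]^p²≡r₁ (p ℕ.^ 2) ⟩
      embed r₁ ^ (p ℕ.^ 2)                         ∼⟨ fermat-iterate p 2 (fermat-embed p-prime r₁) ⟩
      embed r₁                                     ∼⟨ ≡-mod-sym [2ξ]^p²≡r₁ ⟩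
      ((2 × 1ξ) ⊗ ξ) ^ (p ℕ.^ 2)                   ≡⟨ ^-distrib-* (2 × 1ξ) ξ (p ℕ.^ 2) ⟩
      (2 × 1ξ) ^ (p ℕ.^ 2) ⊗ ξ ^ (p ℕ.^ 2)         ∼⟨ *-cong-mod (fermat-iterate p 2 (fermat-× p-prime 2)) ≡-mod-refl ⟩
      (2 × 1ξ) ⊗ ξ ^ (p ℕ.^ 2)                     ∎)
      where
      open ≡-mod-Reasoning (p × 1ξ)
      instance
        2q≢0 : ℕ.NonZero (2 ℕ.* q)
        2q≢0 = ℕ.≢-nonZero λ 2q≡0 → ¬prime[1] (subst Prime (trans p≡1+2q (cong suc 2q≡0)) p-prime)
      E≡0 : E ≡ 0ξ mod p × 1ξ
      E≡0 = ^-≡0-mod (embed-mod (ℤ-mod.∣⇒≡0-mod p∣D)) (2 ℕ.* q)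
      [2ξ]^p²≡r₁ : ((2 × 1ξ) ⊗ ξ) ^ (p ℕ.^ 2) ≡ embed r₁ mod p × 1ξ
      [2ξ]^p²≡r₁ = ≡-mod-trans [2ξ]^p²
        (≡-mod-trans (+-cong-mod ≡-mod-refl (*-cong-mod ≡-mod-refl (^-≡0-mod E≡0 (suc q))))
          (≈⇒≡-mod (trans (cong (embed r₁ ⊕_) (R.zeroʳ δ)) (R.+-identityʳ (embed r₁)))))

  -- Modulo 2, squaring fixes r₁ and r₂, so ξ^(2^(k+1)) ≡ r₁ ξ^(2^k) + r₂; as r₁² ≡ r₁, three
  -- steps of this recurrence agree with one. The prime is a variable p ≡ 2: with a literal
  -- exponent Agda would expand ξ ^ 16.
  module Two {p : ℕ} (p≡2 : p ≡ 2) where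

    open import Algebra.Solver.Ring.NaturalCoefficients.Default R.commutativeSemiring

    private
      A B : ℤ[ξ]
      A = embed r₁
      B = embed r₂

      p-prime : Prime p
      p-prime = subst Prime (sym p≡2) prime[2]

      A²≡A : A ⊗ A ≡ A mod p × 1ξ
      A²≡A = ≡-mod-trans (≈⇒≡-mod A⊗A≡A^p) (fermat-embed p-prime r₁)
        where
        A⊗A≡A^p : A ⊗ A ≡ A ^ p
        A⊗A≡A^p = subst (λ n → A ⊗ A ≡ A ^ n) (sym p≡2) (cong (A ⊗_) (sym (R.*-identityʳ A)))

      x+x≡p×x : ∀ x → x ⊕ x ≡ p × x
      x+x≡p×x x = subst (λ n → x ⊕ x ≡ n × x) (sym p≡2) (cong (x ⊕_) (sym (R.+-identityʳ x)))

      ξ^p^suc : ∀ k → ξ ^ (p ℕ.^ suc k) ≡ A ⊗ ξ ^ (p ℕ.^ k) ⊕ B mod p × 1ξ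
      ξ^p^suc zero = ≈⇒≡-mod (subst (λ n → ξ ^ (n ℕ.^ 1) ≡ A ⊗ ξ ^ 1 ⊕ B) (sym p≡2) (begin
        ξ ⊗ (ξ ⊗ 1ξ)      ≡⟨ cong (ξ ⊗_) (R.*-identityʳ ξ) ⟩
        ξ ⊗ ξ             ≡⟨ ξ-squared ⟩
        A ⊗ ξ ⊕ B         ≡⟨ cong (λ x → A ⊗ x ⊕ B) (R.*-identityʳ ξ) ⟨
        A ⊗ (ξ ⊗ 1ξ) ⊕ B  ∎))
        where open ≡.≡-Reasoning
      ξ^p^suc (suc k) = begin
        ξ ^ (p ℕ.^ suc (suc k))                ≡⟨ ^-p^-sucʳ p (suc k) ξ ⟩
        (ξ ^ (p ℕ.^ suc k)) ^ p                ∼⟨ ^-cong-mod (ξ^p^suc k) p ⟩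
        (A ⊗ ξ ^ (p ℕ.^ k) ⊕ B) ^ p            ∼⟨ frobenius p-prime (A ⊗ ξ ^ (p ℕ.^ k)) B ⟩
        (A ⊗ ξ ^ (p ℕ.^ k)) ^ p ⊕ B ^ p        ≡⟨ cong (_⊕ B ^ p) (^-distrib-* A (ξ ^ (p ℕ.^ k)) p) ⟩
        A ^ p ⊗ (ξ ^ (p ℕ.^ k)) ^ p ⊕ B ^ p    ∼⟨ +-cong-mod (*-cong-mod (fermat-embed p-prime r₁) ≡-mod-refl) (fermat-embed p-prime r₂) ⟩
        A ⊗ (ξ ^ (p ℕ.^ k)) ^ p ⊕ B            ≡⟨ cong (λ x → A ⊗ x ⊕ B) (^-p^-sucʳ p k ξ) ⟨
        A ⊗ ξ ^ (p ℕ.^ suc k) ⊕ B              ∎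
        where open ≡-mod-Reasoning (p × 1ξ)

      ξ^p^[3+k]≡ξ^p^[1+k] : ∀ k → ξ ^ (p ℕ.^ (3 ℕ.+ k)) ≡ ξ ^ (p ℕ.^ (1 ℕ.+ k)) mod p × 1ξ
      ξ^p^[3+k]≡ξ^p^[1+k] k = begin
        ξ ^ (p ℕ.^ (3 ℕ.+ k))                                       ∼⟨ ξ^p^suc (2 ℕ.+ k) ⟩
        A ⊗ ξ ^ (p ℕ.^ (2 ℕ.+ k)) ⊕ B                               ∼⟨ +-cong-mod (*-cong-mod ≡-mod-refl (ξ^p^suc (1 ℕ.+ k))) ≡-mod-refl ⟩
        A ⊗ (A ⊗ ξ ^ (p ℕ.^ (1 ℕ.+ k)) ⊕ B) ⊕ B                     ∼⟨ +-cong-mod (*-cong-mod ≡-mod-refl (+-cong-mod (*-cong-mod ≡-mod-refl (ξ^p^suc k)) ≡-mod-refl)) ≡-mod-refl ⟩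
        A ⊗ (A ⊗ (A ⊗ y ⊕ B) ⊕ B) ⊕ B                               ≡⟨ solve 3 (λ A B y → A :* (A :* (A :* y :+ B) :+ B) :+ B
                                                                     := (A :* A) :* (A :* y) :+ ((A :* A) :* B :+ A :* B) :+ B) refl A B y ⟩
        (A ⊗ A) ⊗ (A ⊗ y) ⊕ ((A ⊗ A) ⊗ B ⊕ A ⊗ B) ⊕ B               ∼⟨ +-cong-mod (+-cong-mod (*-cong-mod A²≡A ≡-mod-refl) (+-cong-mod (*-cong-mod A²≡A ≡-mod-refl) ≡-mod-refl)) ≡-mod-refl ⟩
        A ⊗ (A ⊗ y) ⊕ (A ⊗ B ⊕ A ⊗ B) ⊕ B                           ≡⟨ cong₂ (λ u v → u ⊕ v ⊕ B) (R.*-assoc A A y) (sym (x+x≡p×x (A ⊗ B))) ⟨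
        (A ⊗ A) ⊗ y ⊕ p × (A ⊗ B) ⊕ B                               ∼⟨ +-cong-mod (+-cong-mod (*-cong-mod A²≡A ≡-mod-refl) (∣⇒×≡0-mod (A ⊗ B) (ℕ.∣-refl {p}))) ≡-mod-refl ⟩
        A ⊗ y ⊕ 0ξ ⊕ B                                     ≡⟨ cong (_⊕ B) (R.+-identityʳ (A ⊗ y)) ⟩
        A ⊗ y ⊕ B                                                   ∼⟨ ≡-mod-sym (ξ^p^suc k) ⟩
        ξ ^ (p ℕ.^ (1 ℕ.+ k))                                       ∎
        where
        open ≡-mod-Reasoning (p × 1ξ)
        y : ℤ[ξ]
        y = ξ ^ (p ℕ.^ k)

    ramified : ξ ^ (p ℕ.^ 4) ≡ ξ ^ (p ℕ.^ 2) mod p × 1ξ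
    ramified = ξ^p^[3+k]≡ξ^p^[1+k] 1

  ξ-period-unramified : ∀ {p} → Prime p → ¬ (p ∣ 2 ℕ.* ℤ.∣ D ∣) → ξ ^ (p ℕ.^ 2) ≡ ξ mod p × 1ξ
  ξ-period-unramified {p} p-prime p∤2D with odd-prime p-prime p≢2
    where
    p≢2 : p ≢ 2
    p≢2 refl = p∤2D (ℕ.m∣m*n ℤ.∣ D ∣)
  ... | q , p≡1+2q = OddPrime.unramified {q = q} p-prime p≡1+2q (λ p∣D → p∤2D (ℕ.∣-trans p∣D (ℕ.n∣m*n 2)))

  ξ-period-ramified : ∀ {p} → Prime p → p ∣ 2 ℕ.* ℤ.∣ D ∣ → ξ ^ (p ℕ.^ 4) ≡ ξ ^ (p ℕ.^ 2) mod p × 1ξ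
  ξ-period-ramified {p} p-prime p∣2D with p ℕ.≟ 2
  ... | yes p≡2 = Two.ramified p≡2
  ... | no p≢2 with odd-prime p-prime p≢2 | euclidsLemma 2 ℤ.∣ D ∣ p-prime p∣2D
  ...   | q , p≡1+2q | inj₂ p∣D = OddPrime.ramified {q = q} p-prime p≡1+2q p∣D
  ...   | _          | inj₁ p∣2 = contradiction (prime∣2⇒≡2 p-prime p∣2) p≢2

  ξ^-recurrence : ∀ n → ξ ^ suc (suc n) ≡ embed r₁ ⊗ ξ ^ suc n ⊕ embed r₂ ⊗ ξ ^ n
  ξ^-recurrence n = begin
    ξ ⊗ (ξ ⊗ ξ ^ n)                               ≡⟨ R.*-assoc ξ ξ (ξ ^ n) ⟨
    (ξ ⊗ ξ) ⊗ ξ ^ n                               ≡⟨ cong (_⊗ ξ ^ n) ξ-squared ⟩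
    (embed r₁ ⊗ ξ ⊕ embed r₂) ⊗ ξ ^ n             ≡⟨ ⊗-distribʳ (ξ ^ n) (embed r₁ ⊗ ξ) (embed r₂) ⟩
    (embed r₁ ⊗ ξ) ⊗ ξ ^ n ⊕ embed r₂ ⊗ ξ ^ n     ≡⟨ cong (_⊕ embed r₂ ⊗ ξ ^ n) (R.*-assoc (embed r₁) ξ (ξ ^ n)) ⟩
    embed r₁ ⊗ (ξ ⊗ ξ ^ n) ⊕ embed r₂ ⊗ ξ ^ n     ∎
    where open ≡.≡-Reasoning

  ξ^-*-cong-mod : ∀ {m M N} k → ξ ^ M ≡ ξ ^ N mod m → ξ ^ (k ℕ.* M) ≡ ξ ^ (k ℕ.* N) mod m
  ξ^-*-cong-mod {m} {M} {N} k ξ^M≡ξ^N = begin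
    ξ ^ (k ℕ.* M)     ≡⟨ ξ^[k*M]≡[ξ^M]^k M ⟩
    (ξ ^ M) ^ k       ∼⟨ ^-cong-mod ξ^M≡ξ^N k ⟩
    (ξ ^ N) ^ k       ≡⟨ ξ^[k*M]≡[ξ^M]^k N ⟨
    ξ ^ (k ℕ.* N)     ∎
    where
    open ≡-mod-Reasoning m
    ξ^[k*M]≡[ξ^M]^k : ∀ M → ξ ^ (k ℕ.* M) ≡ (ξ ^ M) ^ k
    ξ^[k*M]≡[ξ^M]^k M = trans (cong (ξ ^_) (ℕ.*-comm k M)) (sym (^-assocʳ ξ M k))

  [p×1ξ]^k≡embed : ∀ p k → (p × 1ξ) ^ k ≡ embed (+ (p ℕ.^ k))
  [p×1ξ]^k≡embed p k = begin
    (p × 1ξ) ^ k         ≡⟨ cong (_^ k) (n×1≡embed p) ⟩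
    embed (+ p) ^ k      ≡⟨ embed-^ (+ p) k ⟨
    embed ((+ p) ℤ-mod.^ k) ≡⟨ cong embed (ℤ-mod.pos-^ p k) ⟩
    embed (+ (p ℕ.^ k))  ∎
    where open ≡.≡-Reasoning

  module LucasSequence (U : ℕ → ℤ) (U-rec : IsLucasSeq r₁ r₂ U) where

    ⟦_⟧ : ℤ[ξ] → ℤ
    ⟦ ⟨ a , b ⟩ ⟧ = a * U 0 + b * U 1

    private
      ⟦⟧-⊕′ : ∀ a b c d U₀ U₁ → (a + c) * U₀ + (b + d) * U₁ ≡ (a * U₀ + b * U₁) + (c * U₀ + d * U₁)
      ⟦⟧-⊕′ = solve-∀
      ⟦⟧-embed-⊗′ : ∀ r₁ r₂ a c d U₀ U₁ → (a * c + r₂ * (+ 0 * d)) * U₀ + (a * d + + 0 * c + r₁ * (+ 0 * d)) * U₁ ≡ a * (c * U₀ + d * U₁)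
      ⟦⟧-embed-⊗′ = solve-∀
      ⟦1⟧ : ∀ U₀ U₁ → U₀ ≡ + 1 * U₀ + + 0 * U₁
      ⟦1⟧ = solve-∀
      ⟦ξ⟧ : ∀ r₁ r₂ U₀ U₁ → U₁ ≡ (+ 0 * + 1 + r₂ * (+ 1 * + 0)) * U₀ + (+ 0 * + 0 + + 1 * + 1 + r₁ * (+ 1 * + 0)) * U₁
      ⟦ξ⟧ = solve-∀

    ⟦⟧-⊕ : ∀ x y → ⟦ x ⊕ y ⟧ ≡ ⟦ x ⟧ + ⟦ y ⟧
    ⟦⟧-⊕ ⟨ a , b ⟩ ⟨ c , d ⟩ = ⟦⟧-⊕′ a b c d (U 0) (U 1)

    ⟦⟧-embed-⊗ : ∀ a x → ⟦ embed a ⊗ x ⟧ ≡ a * ⟦ x ⟧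
    ⟦⟧-embed-⊗ a ⟨ c , d ⟩ = ⟦⟧-embed-⊗′ r₁ r₂ a c d (U 0) (U 1)

    ⟦⟧-mod : ∀ {x y m} → x ≡ y mod embed m → ⟦ x ⟧ ℤ-mod.≡ ⟦ y ⟧ mod m
    ⟦⟧-mod {x} {y} {m} (congruent w x≡y+mw) = ℤ-mod.congruent ⟦ w ⟧ (begin
      ⟦ x ⟧                        ≡⟨ cong ⟦_⟧ x≡y+mw ⟩
      ⟦ y ⊕ embed m ⊗ w ⟧          ≡⟨ ⟦⟧-⊕ y (embed m ⊗ w) ⟩
      ⟦ y ⟧ + ⟦ embed m ⊗ w ⟧      ≡⟨ cong (λ z → ⟦ y ⟧ + z) (⟦⟧-embed-⊗ m w) ⟩
      ⟦ y ⟧ + m * ⟦ w ⟧            ∎)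
      where open ≡.≡-Reasoning

    U≡⟦ξ^⟧ : ∀ n → U n ≡ ⟦ ξ ^ n ⟧
    U≡⟦ξ^⟧ zero          = ⟦1⟧ (U 0) (U 1)
    U≡⟦ξ^⟧ (suc zero)    = ⟦ξ⟧ r₁ r₂ (U 0) (U 1)
    U≡⟦ξ^⟧ (suc (suc n)) = begin
      U (suc (suc n))                                        ≡⟨ U-rec n ⟩
      r₁ * U (suc n) + r₂ * U n                              ≡⟨ cong₂ (λ a b → r₁ * a + r₂ * b) (U≡⟦ξ^⟧ (suc n)) (U≡⟦ξ^⟧ n) ⟩
      r₁ * ⟦ ξ ^ suc n ⟧ + r₂ * ⟦ ξ ^ n ⟧                    ≡⟨ cong₂ _+_ (⟦⟧-embed-⊗ r₁ (ξ ^ suc n)) (⟦⟧-embed-⊗ r₂ (ξ ^ n)) ⟨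
      ⟦ embed r₁ ⊗ ξ ^ suc n ⟧ + ⟦ embed r₂ ⊗ ξ ^ n ⟧        ≡⟨ ⟦⟧-⊕ (embed r₁ ⊗ ξ ^ suc n) (embed r₂ ⊗ ξ ^ n) ⟨
      ⟦ embed r₁ ⊗ ξ ^ suc n ⊕ embed r₂ ⊗ ξ ^ n ⟧            ≡⟨ cong ⟦_⟧ (ξ^-recurrence n) ⟨
      ⟦ ξ ^ suc (suc n) ⟧                                    ∎
      where open ≡.≡-Reasoning

    U-cong-mod : ∀ {p k M N} → ξ ^ M ≡ ξ ^ N mod (p × 1ξ) ^ k → U M ℤ-mod.≡ U N mod + (p ℕ.^ k)
    U-cong-mod {p} {k} {M} {N} ξ^M≡ξ^N = subst₂ (λ a b → a ℤ-mod.≡ b mod + (p ℕ.^ k)) (sym (U≡⟦ξ^⟧ M)) (sym (U≡⟦ξ^⟧ N))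
      (⟦⟧-mod (subst (ξ ^ M ≡ ξ ^ N mod_) ([p×1ξ]^k≡embed p k) ξ^M≡ξ^N))

-- Möbius sums and the Dold condition

module FiniteSums where

  open import Data.Integer using (_+_)
  open IntegerCongruence using (_≡_mod_; ≡-mod-refl; ≡-mod-trans; +-cong-mod; ≈⇒≡-mod)

  infixr 7 [_]·_
  [_]·_ : Bool → ℤ → ℤ
  [ b ]· x = if b then x else + 0

  -- f 1 + ⋯ + f n: the index starts at 1.
  sumTo : ℕ → (ℕ → ℤ) → ℤ
  sumTo zero    f = + 0
  sumTo (suc n) f = sumTo n f + f (suc n)

  private variable
    f g : ℕ → ℤ

  sumTo-cong : ∀ n → (∀ {d} → 1 ≤ d → d ≤ n → f d ≡ g d) → sumTo n f ≡ sumTo n g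
  sumTo-cong zero    f≡g = refl
  sumTo-cong (suc n) f≡g = cong₂ _+_ (sumTo-cong n (λ 1≤d d≤n → f≡g 1≤d (ℕ.m≤n⇒m≤1+n d≤n))) (f≡g (s≤s z≤n) ℕ.≤-refl)

  sumTo-+ : ∀ n f g → sumTo n (λ d → f d + g d) ≡ sumTo n f + sumTo n g
  sumTo-+ zero    f g = refl
  sumTo-+ (suc n) f g = trans (cong (_+ (f (suc n) + g (suc n))) (sumTo-+ n f g))
                              (medial (sumTo n f) (sumTo n g) (f (suc n)) (g (suc n)))
    where
    medial : ∀ a b c d → (a + b) + (c + d) ≡ (a + c) + (b + d)
    medial = solve-∀

  sumTo-zero : ∀ n → (∀ {d} → 1 ≤ d → d ≤ n → f d ≡ + 0) → sumTo n f ≡ + 0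
  sumTo-zero zero    f≡0 = refl
  sumTo-zero (suc n) f≡0 = cong₂ _+_ (sumTo-zero n (λ 1≤d d≤n → f≡0 1≤d (ℕ.m≤n⇒m≤1+n d≤n))) (f≡0 (s≤s z≤n) ℕ.≤-refl)

  sumTo-+-split : ∀ m n f → sumTo (m ℕ.+ n) f ≡ sumTo m f + sumTo n (λ r → f (m ℕ.+ r))
  sumTo-+-split m zero    f = trans (cong (λ k → sumTo k f) (ℕ.+-identityʳ m)) (sym (ℤ.+-identityʳ (sumTo m f)))
  sumTo-+-split m (suc n) f = begin
    sumTo (m ℕ.+ suc n) f                                         ≡⟨ cong (λ k → sumTo k f) (ℕ.+-suc m n) ⟩
    sumTo (m ℕ.+ n) f + f (suc (m ℕ.+ n))                         ≡⟨ cong₂ _+_ (sumTo-+-split m n f) (cong f (sym (ℕ.+-suc m n))) ⟩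
    (sumTo m f + sumTo n (λ r → f (m ℕ.+ r))) + f (m ℕ.+ suc n)   ≡⟨ ℤ.+-assoc (sumTo m f) _ _ ⟩
    sumTo m f + sumTo (suc n) (λ r → f (m ℕ.+ r))                 ∎
    where open ≡.≡-Reasoning

  sumTo-extend : ∀ m n → (∀ {d} → m < d → f d ≡ + 0) → sumTo (m ℕ.+ n) f ≡ sumTo m f
  sumTo-extend {f} m n f≡0 = begin
    sumTo (m ℕ.+ n) f                              ≡⟨ sumTo-+-split m n f ⟩
    sumTo m f + sumTo n (λ r → f (m ℕ.+ r))        ≡⟨ cong (λ z → sumTo m f + z) (sumTo-zero n (λ 1≤r _ → f≡0 (ℕ.m<m+n m 1≤r))) ⟩
    sumTo m f + + 0                                ≡⟨ ℤ.+-identityʳ (sumTo m f) ⟩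
    sumTo m f                                      ∎
    where open ≡.≡-Reasoning

  sumTo≡0-mod : ∀ {m} n → (∀ {d} → 1 ≤ d → d ≤ n → f d ≡ + 0 mod m) → sumTo n f ≡ + 0 mod m
  sumTo≡0-mod zero    f≡0 = ≡-mod-refl
  sumTo≡0-mod (suc n) f≡0 = ≡-mod-trans (+-cong-mod (sumTo≡0-mod n (λ 1≤d d≤n → f≡0 1≤d (ℕ.m≤n⇒m≤1+n d≤n))) (f≡0 (s≤s z≤n) ℕ.≤-refl))
                                        (≈⇒≡-mod refl)

  sumTo-multiples : ∀ p .{{_ : NonZero p}} N (φ : ℕ → ℤ) → sumTo (N ℕ.* p) (λ d → [ does (p ∣? d) ]· φ d) ≡ sumTo N (λ e → φ (e ℕ.* p))
  sumTo-multiples p zero    φ = refl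
  sumTo-multiples p@(suc p′) (suc N) φ = begin
    sumTo (p ℕ.+ N ℕ.* p) ψ                                   ≡⟨ cong (λ k → sumTo k ψ) (ℕ.+-comm p (N ℕ.* p)) ⟩
    sumTo (N ℕ.* p ℕ.+ p) ψ                                   ≡⟨ sumTo-+-split (N ℕ.* p) p ψ ⟩
    sumTo (N ℕ.* p) ψ + sumTo p (λ r → ψ (N ℕ.* p ℕ.+ r))     ≡⟨ cong₂ _+_ (sumTo-multiples p N φ) last-block ⟩
    sumTo N (λ e → φ (e ℕ.* p)) + φ (suc N ℕ.* p)             ∎
    where
    open ≡.≡-Reasoning
    ψ : ℕ → ℤ
    ψ d = [ does (p ∣? d) ]· φ d
    p∤Np+r : ∀ {r} → 1 ≤ r → r ≤ p′ → ¬ (p ∣ N ℕ.* p ℕ.+ r)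
    p∤Np+r {r} 1≤r r≤p′ p∣ = ℕ.<⇒≱ (s≤s r≤p′) (ℕ.∣⇒≤ {{ℕ.>-nonZero 1≤r}} (ℕ.∣m+n∣m⇒∣n p∣ (ℕ.n∣m*n N)))
    p∣Np+p : p ∣ N ℕ.* p ℕ.+ p
    p∣Np+p = ℕ.∣m∣n⇒∣m+n (ℕ.n∣m*n N) ℕ.∣-refl
    last-block : sumTo p (λ r → ψ (N ℕ.* p ℕ.+ r)) ≡ φ (suc N ℕ.* p)
    last-block = begin
      sumTo p′ (λ r → ψ (N ℕ.* p ℕ.+ r)) + ψ (N ℕ.* p ℕ.+ p)
        ≡⟨ cong₂ _+_ (sumTo-zero p′ (λ {r} 1≤r r≤p′ → cong (λ b → [ b ]· φ (N ℕ.* p ℕ.+ r)) (dec-false (p ∣? _) (p∤Np+r 1≤r r≤p′))))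
                     (cong (λ b → [ b ]· φ (N ℕ.* p ℕ.+ p)) (dec-true (p ∣? _) p∣Np+p)) ⟩
      + 0 + φ (N ℕ.* p ℕ.+ p)   ≡⟨ ℤ.+-identityˡ _ ⟩
      φ (N ℕ.* p ℕ.+ p)         ≡⟨ cong φ (ℕ.+-comm (N ℕ.* p) p) ⟩
      φ (suc N ℕ.* p)           ∎

  [b]·0≡0 : ∀ b → [ b ]· + 0 ≡ + 0
  [b]·0≡0 true  = refl
  [b]·0≡0 false = refl

  sumTo-point : ∀ {n k} x → 1 ≤ k → k ≤ n → sumTo n (λ d → [ does (d ℕ.≟ k) ]· x) ≡ x
  sumTo-point {n} {k@(suc k′)} x _ k≤n = begin
    sumTo n δₖ                        ≡⟨ cong (λ m → sumTo m δₖ) (ℕ.m+[n∸m]≡n k≤n) ⟨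
    sumTo (k ℕ.+ (n ℕ.∸ k)) δₖ        ≡⟨ sumTo-extend k (n ℕ.∸ k) (λ k<d → cong (λ b → [ b ]· x) (dec-false (_ ℕ.≟ k) (ℕ.>⇒≢ k<d))) ⟩
    sumTo k′ δₖ + δₖ k                ≡⟨ cong₂ _+_ (sumTo-zero k′ (λ _ d≤k′ → cong (λ b → [ b ]· x) (dec-false (_ ℕ.≟ k) (ℕ.<⇒≢ (s≤s d≤k′)))))
                                                   (cong (λ b → [ b ]· x) (dec-true (k ℕ.≟ k) refl)) ⟩
    + 0 + x                           ≡⟨ ℤ.+-identityˡ x ⟩
    x                                 ∎
    where
    open ≡.≡-Reasoning
    δₖ : ℕ → ℤ
    δₖ d = [ does (d ℕ.≟ k) ]· x

  sumℤ-++ : ∀ xs ys → sumℤ (xs ++ ys) ≡ sumℤ xs + sumℤ ys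
  sumℤ-++ []       ys = sym (ℤ.+-identityˡ (sumℤ ys))
  sumℤ-++ (x ∷ xs) ys = trans (cong (λ z → x + z) (sumℤ-++ xs ys)) (sym (ℤ.+-assoc x (sumℤ xs) (sumℤ ys)))

  sumℤ-upTo : ∀ n f → sumℤ (map f (map suc (upTo n))) ≡ sumTo n f
  sumℤ-upTo zero    f = refl
  sumℤ-upTo (suc n) f = begin
    sumℤ (map f (map suc (upTo (suc n))))      ≡⟨ cong (λ xs → sumℤ (map f (map suc xs))) (List.upTo-∷ʳ n) ⟨
    sumℤ (map f (map suc (upTo n ∷ʳ n)))       ≡⟨ cong (λ xs → sumℤ (map f xs)) (List.map-++ suc (upTo n) (n ∷ [])) ⟩
    sumℤ (map f (map suc (upTo n) ∷ʳ suc n))   ≡⟨ cong sumℤ (List.map-++ f (map suc (upTo n)) (suc n ∷ [])) ⟩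
    sumℤ (map f (map suc (upTo n)) ∷ʳ f (suc n)) ≡⟨ sumℤ-++ (map f (map suc (upTo n))) (f (suc n) ∷ []) ⟩
    sumℤ (map f (map suc (upTo n))) + (f (suc n) + + 0) ≡⟨ cong₂ _+_ (sumℤ-upTo n f) (ℤ.+-identityʳ (f (suc n))) ⟩
    sumTo (suc n) f                            ∎
    where open ≡.≡-Reasoning

  sumℤ-filter : ∀ {P : Pred ℕ 0ℓ} (P? : Decidable P) f xs → sumℤ (map f (filter P? xs)) ≡ sumℤ (map (λ x → [ does (P? x) ]· f x) xs)
  sumℤ-filter P? f [] = refl
  sumℤ-filter P? f (x ∷ xs) with does (P? x)
  ... | true  = cong (λ z → f x + z) (sumℤ-filter P? f xs)
  ... | false = trans (sumℤ-filter P? f xs) (sym (ℤ.+-identityˡ _))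

  length≡sumℤ : ∀ {A : Set} (xs : List A) → + length xs ≡ sumℤ (map (λ _ → + 1) xs)
  length≡sumℤ []       = refl
  length≡sumℤ (x ∷ xs) = trans (ℤ.pos-+ 1 (length xs)) (cong (λ z → + 1 + z) (length≡sumℤ xs))

  sumℤ-divisors : ∀ n f → sumℤ (map f (divisors n)) ≡ sumTo n (λ d → [ does (d ∣? n) ]· f d)
  sumℤ-divisors n f = trans (sumℤ-filter (_∣? n) f (map suc (upTo n))) (sumℤ-upTo n _)

module Möbius where

  open import Data.Integer using (_+_; _*_; -_)
  open import Data.Product using (_×_)
  open FiniteSums

  private
    T-does⇒ : ∀ {A : Set} (a? : Dec A) → T (does a?) → A
    T-does⇒ (yes a) _ = a

    square-test : ℕ → ℕ → Bool
    square-test n d = does ((suc (suc d) ℕ.* suc (suc d)) ∣? n)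

  squarefree?≡false : ∀ {n d} → .{{NonZero n}} → 2 ≤ d → d ℕ.* d ∣ n → squarefree? n ≡ false
  squarefree?≡false {d = zero} () _
  squarefree?≡false {d = suc zero} (s≤s ()) _
  squarefree?≡false {n} {suc (suc d′)} _ dd∣n =
    cong not (Equivalence.to T-≡ (any⁺ (square-test n) (lose (∈-upTo⁺ d′<n) (Equivalence.from T-≡ (dec-true (_ ∣? n) dd∣n)))))
    where
    d′<n : d′ < n
    d′<n = ℕ.<-≤-trans (ℕ.m<n+m d′ {2} (s≤s z≤n)) (ℕ.≤-trans (ℕ.m≤m*n (suc (suc d′)) (suc (suc d′))) (ℕ.∣⇒≤ dd∣n))

  squarefree?≡false⇒ : ∀ {n} → squarefree? n ≡ false → ∃[ d ] 2 ≤ d × d ℕ.* d ∣ n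
  squarefree?≡false⇒ {n} sf≡false with any (square-test n) (upTo n) in any≡true
  ... | true with Any.satisfied (any⁻ (square-test n) (upTo n) (Equivalence.from T-≡ any≡true))
  ...   | d , dd∣n = suc (suc d) , s≤s (s≤s z≤n) , T-does⇒ (_ ∣? n) dd∣n

  square∣*prime⇒square∣ : ∀ {d e p} → Prime p → ¬ (p ∣ e) → d ℕ.* d ∣ e ℕ.* p → d ℕ.* d ∣ e
  square∣*prime⇒square∣ {d} {e} {p} p-prime p∤e dd∣ep with p ∣? d
  ... | yes p∣d = contradiction (ℕ.*-cancelʳ-∣ p {{prime⇒nonZero p-prime}} (ℕ.∣-trans (ℕ.*-pres-∣ p∣d p∣d) dd∣ep)) p∤e
  ... | no p∤d  = coprime-divisor coprime (subst (d ℕ.* d ∣_) (ℕ.*-comm e p) dd∣ep)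
    where
    coprime : Coprime (d ℕ.* d) p
    coprime (i∣dd , i∣p) with prime⇒irreducible p-prime i∣p
    ... | inj₁ i≡1 = i≡1
    ... | inj₂ refl with euclidsLemma d d p-prime i∣dd
    ...   | inj₁ p∣d = contradiction p∣d p∤d
    ...   | inj₂ p∣d = contradiction p∣d p∤d

  squarefree?-*-prime : ∀ {e p} → .{{NonZero e}} → Prime p → ¬ (p ∣ e) → squarefree? (e ℕ.* p) ≡ squarefree? e
  squarefree?-*-prime {e} {p} {{e≢0}} p-prime p∤e with squarefree? e in sf-e
  ... | false with squarefree?≡false⇒ {e} sf-e
  ...   | d , 2≤d , dd∣e = squarefree?≡false {e ℕ.* p} {d} {{ℕ.m*n≢0 e p {{e≢0}} {{prime⇒nonZero p-prime}}}} 2≤d (ℕ.∣-trans dd∣e (ℕ.m∣m*n p))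
  squarefree?-*-prime {e} {p} {{e≢0}} p-prime p∤e | true with squarefree? (e ℕ.* p) in sf-ep
  ... | true  = refl
  ... | false with squarefree?≡false⇒ {e ℕ.* p} sf-ep
  ...   | d , 2≤d , dd∣ep with () ← trans (sym sf-e) (squarefree?≡false {e} {d} 2≤d (square∣*prime⇒square∣ {d} p-prime p∤e dd∣ep))

  μ-unfold : ∀ n → μ n ≡ (if squarefree? n then (- + 1) ℤ.^ ω n else + 0)
  μ-unfold n with squarefree? n
  ... | true  = refl
  ... | false = refl

  ω-as-sum : ∀ n → + ω n ≡ sumTo n (λ d → [ does (d ∣? n) ]· [ does (prime? d) ]· + 1)
  ω-as-sum n = begin
    + ω n                                                        ≡⟨ length≡sumℤ (filter prime? (divisors n)) ⟩
    sumℤ (map (λ _ → + 1) (filter prime? (divisors n)))          ≡⟨ sumℤ-filter prime? (λ _ → + 1) (divisors n) ⟩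
    sumℤ (map (λ d → [ does (prime? d) ]· + 1) (divisors n))     ≡⟨ sumℤ-divisors n (λ d → [ does (prime? d) ]· + 1) ⟩
    sumTo n (λ d → [ does (d ∣? n) ]· [ does (prime? d) ]· + 1)  ∎
    where open ≡.≡-Reasoning

  module _ {e p : ℕ} .{{_ : NonZero e}} (p-prime : Prime p) where

    private
      instance
        p≢0 : NonZero p
        p≢0 = prime⇒nonZero p-prime

      prime-divisor : ℕ → ℕ → ℤ
      prime-divisor n d = [ does (d ∣? n) ]· [ does (prime? d) ]· + 1

      is-p : ℕ → ℤ
      is-p d = [ does (d ℕ.≟ p) ]· + 1

      ≢p⇒is-p≡0 : ∀ {d} → d ≢ p → is-p d ≡ + 0
      ≢p⇒is-p≡0 d≢p = cong (λ b → [ b ]· + 1) (dec-false (_ ℕ.≟ p) d≢p)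

      prime-divisor-* : ¬ (p ∣ e) → ∀ d → prime-divisor (e ℕ.* p) d ≡ prime-divisor e d + is-p d
      prime-divisor-* p∤e d with prime? d | d ∣? e
      ... | no ¬d-prime | d∣?e = trans ([b]·0≡0 _)
        (sym (cong₂ _+_ ([b]·0≡0 (does d∣?e)) (≢p⇒is-p≡0 (λ d≡p → ¬d-prime (subst Prime (sym d≡p) p-prime)))))
      ... | yes d-prime | yes d∣e = trans (cong (λ b → [ b ]· + 1) (dec-true (d ∣? e ℕ.* p) (ℕ.∣-trans d∣e (ℕ.m∣m*n p))))
        (cong (λ i → + 1 + i) (sym (≢p⇒is-p≡0 {d} (λ { refl → p∤e d∣e }))))
      ... | yes d-prime | no d∤e with d ℕ.≟ p
      ...   | yes refl = trans (cong (λ b → [ b ]· + 1) (dec-true (p ∣? e ℕ.* p) (ℕ.n∣m*n e)))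
        (sym (trans (ℤ.+-identityˡ _) (cong (λ b → [ b ]· + 1) (dec-true (p ℕ.≟ p) refl))))
      ...   | no d≢p   = trans (cong (λ b → [ b ]· + 1) (dec-false (d ∣? e ℕ.* p) d∤ep))
        (sym (trans (ℤ.+-identityˡ _) (≢p⇒is-p≡0 d≢p)))
        where
        d∤ep : ¬ (d ∣ e ℕ.* p)
        d∤ep d∣ep with euclidsLemma e p d-prime d∣ep
        ... | inj₁ d∣e = d∤e d∣e
        ... | inj₂ d∣p with prime⇒irreducible p-prime d∣p
        ...   | inj₁ refl = ¬prime[1] d-prime
        ...   | inj₂ d≡p  = d≢p d≡p

    ω-*-prime : ¬ (p ∣ e) → ω (e ℕ.* p) ≡ suc (ω e)
    ω-*-prime p∤e = ℤ.+-injective (begin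
      + ω (e ℕ.* p)                                                   ≡⟨ ω-as-sum (e ℕ.* p) ⟩
      sumTo (e ℕ.* p) (prime-divisor (e ℕ.* p))                       ≡⟨ sumTo-cong (e ℕ.* p) (λ {d} _ _ → prime-divisor-* p∤e d) ⟩
      sumTo (e ℕ.* p) (λ d → prime-divisor e d + is-p d)              ≡⟨ sumTo-+ (e ℕ.* p) (prime-divisor e) is-p ⟩
      sumTo (e ℕ.* p) (prime-divisor e) + sumTo (e ℕ.* p) is-p        ≡⟨ cong₂ _+_ truncate (sumTo-point (+ 1) (ℕ.n≢0⇒n>0 (ℕ.≢-nonZero⁻¹ p)) (ℕ.m≤n*m p e)) ⟩
      sumTo e (prime-divisor e) + + 1                                 ≡⟨ cong (_+ + 1) (ω-as-sum e) ⟨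
      + ω e + + 1                                                     ≡⟨ ℤ.+-comm (+ ω e) (+ 1) ⟩
      + suc (ω e)                                                     ∎)
      where
      open ≡.≡-Reasoning
      truncate : sumTo (e ℕ.* p) (prime-divisor e) ≡ sumTo e (prime-divisor e)
      truncate = trans (cong (λ m → sumTo m (prime-divisor e)) (sym (ℕ.m+[n∸m]≡n (ℕ.m≤m*n e p))))
        (sumTo-extend e (e ℕ.* p ℕ.∸ e) (λ e<d → cong (λ b → [ b ]· _) (dec-false (_ ∣? e) (λ d∣e → ℕ.<⇒≱ e<d (ℕ.∣⇒≤ d∣e)))))

    μ-*-prime : ¬ (p ∣ e) → μ (e ℕ.* p) ≡ - μ e
    μ-*-prime p∤e = begin
      μ (e ℕ.* p)                                                              ≡⟨ μ-unfold (e ℕ.* p) ⟩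
      (if squarefree? (e ℕ.* p) then (- + 1) ℤ.^ ω (e ℕ.* p) else + 0)         ≡⟨ cong₂ (λ b k → if b then (- + 1) ℤ.^ k else + 0) (squarefree?-*-prime p-prime p∤e) (ω-*-prime p∤e) ⟩
      (if squarefree? e then (- + 1) ℤ.^ suc (ω e) else + 0)                   ≡⟨ flip-sign (squarefree? e) ⟩
      - (if squarefree? e then (- + 1) ℤ.^ ω e else + 0)                       ≡⟨ cong -_ (μ-unfold e) ⟨
      - μ e                                                                    ∎
      where
      open ≡.≡-Reasoning
      flip-sign : ∀ b → (if b then (- + 1) ℤ.^ suc (ω e) else + 0) ≡ - (if b then (- + 1) ℤ.^ ω e else + 0)
      flip-sign true  = ℤ.-1*i≡-i ((- + 1) ℤ.^ ω e)
      flip-sign false = refl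

    μ-*-prime-∣ : p ∣ e → μ (e ℕ.* p) ≡ + 0
    μ-*-prime-∣ p∣e = trans (μ-unfold (e ℕ.* p)) (cong (λ b → if b then (- + 1) ℤ.^ ω (e ℕ.* p) else + 0)
      (squarefree?≡false {e ℕ.* p} {p} {{ℕ.m*n≢0 e p}} (ℕ.nonTrivial⇒n>1 p {{prime⇒nonTrivial p-prime}}) (ℕ.*-pres-∣ p∣e ℕ.∣-refl)))

module DoldCriterion where

  open import Data.Integer using (_+_; _*_; -_)
  open IntegerCongruence
  open FiniteSums
  open Möbius

  möbius-transform : (ℕ → ℤ) → ℕ → ℤ
  möbius-transform B n = sumℤ (map (λ d → μ d * B (n /′ d)) (divisors n))

  private
    /′≡/ : ∀ n d .{{_ : NonZero d}} → n /′ d ≡ n ℕ./ d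
    /′≡/ n (suc d) = refl

    does-cong : ∀ {A B : Set} (A? : Dec A) (B? : Dec B) → (A → B) → (B → A) → does A? ≡ does B?
    does-cong (yes a) B? to from = sym (dec-true B? (to a))
    does-cong (no ¬a) B? to from = sym (dec-false B? (λ b → ¬a (from b)))

    split : ∀ b x → x ≡ [ b ]· x + [ not b ]· x
    split true  x = sym (ℤ.+-identityʳ x)
    split false x = sym (ℤ.+-identityˡ x)

    cancel : ∀ a b → - a * b + a * b ≡ + 0
    cancel = solve-∀

  -- Write the divisors of n divisible by p as e·p. For p ∤ e the terms of e and e·p cancel modulo
  -- p^(j+1) by B-cong, since μ(ep) = −μ(e); for p ∣ e the term of e·p vanishes as μ(ep) = 0.
  module _ (B : ℕ → ℤ) {p : ℕ} (p-prime : Prime p)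
           (B-cong : ∀ j m → B (m ℕ.* p ℕ.^ suc j) ≡ B (m ℕ.* p ℕ.^ j) mod + (p ℕ.^ suc j))
           {n j : ℕ} .{{_ : NonZero n}} (p^j+1∣n : p ℕ.^ suc j ∣ n) where

    private
      instance
        p≢0 : NonZero p
        p≢0 = prime⇒nonZero p-prime

      g : ℕ → ℤ
      g d = [ does (d ∣? n) ]· (μ d * B (n /′ d))

      term : ℕ → ℤ
      term e = g (e ℕ.* p) + [ not (does (p ∣? e)) ]· g e

      multiples : sumTo n (λ d → [ does (p ∣? d) ]· g d) ≡ sumTo n (λ e → g (e ℕ.* p))
      multiples = begin
        sumTo n (λ d → [ does (p ∣? d) ]· g d)                 ≡⟨ sumTo-extend n (n ℕ.* p ℕ.∸ n) g≡0 ⟨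
        sumTo (n ℕ.+ (n ℕ.* p ℕ.∸ n)) (λ d → [ does (p ∣? d) ]· g d) ≡⟨ cong (λ k → sumTo k (λ d → [ does (p ∣? d) ]· g d)) (ℕ.m+[n∸m]≡n (ℕ.m≤m*n n p)) ⟩
        sumTo (n ℕ.* p) (λ d → [ does (p ∣? d) ]· g d)         ≡⟨ sumTo-multiples p n g ⟩
        sumTo n (λ e → g (e ℕ.* p))                            ∎
        where
        open ≡.≡-Reasoning
        g≡0 : ∀ {d} → n < d → [ does (p ∣? d) ]· g d ≡ + 0
        g≡0 {d} n<d = trans (cong (λ b → [ does (p ∣? d) ]· [ b ]· (μ d * B (n /′ d))) (dec-false (d ∣? n) (λ d∣n → ℕ.<⇒≱ n<d (ℕ.∣⇒≤ d∣n))))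
                            ([b]·0≡0 _)

      möbius-transform≡sum-of-terms : möbius-transform B n ≡ sumTo n term
      möbius-transform≡sum-of-terms = begin
        möbius-transform B n                                                 ≡⟨ sumℤ-divisors n (λ d → μ d * B (n /′ d)) ⟩
        sumTo n g                                                            ≡⟨ sumTo-cong n (λ {d} _ _ → split (does (p ∣? d)) (g d)) ⟩
        sumTo n (λ d → [ does (p ∣? d) ]· g d + [ not (does (p ∣? d)) ]· g d) ≡⟨ sumTo-+ n _ _ ⟩
        sumTo n (λ d → [ does (p ∣? d) ]· g d) + sumTo n (λ d → [ not (does (p ∣? d)) ]· g d) ≡⟨ cong (_+ sumTo n (λ d → [ not (does (p ∣? d)) ]· g d)) multiples ⟩
        sumTo n (λ e → g (e ℕ.* p)) + sumTo n (λ d → [ not (does (p ∣? d)) ]· g d) ≡⟨ sumTo-+ n _ _ ⟨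
        sumTo n term                                                         ∎
        where open ≡.≡-Reasoning

      paired≡0 : ∀ {e} → ¬ (p ∣ e) → e ∣ n → - μ e * B (n /′ (e ℕ.* p)) + μ e * B (n /′ e) ≡ + 0 mod + (p ℕ.^ suc j)
      paired≡0 {e} p∤e (divides c n≡ce) with prime^∣*⇒∣ (suc j) p-prime p∤e (subst (p ℕ.^ suc j ∣_) n≡ce p^j+1∣n)
      ... | divides m c≡mp^j+1 = begin
        - μ e * B (n /′ (e ℕ.* p)) + μ e * B (n /′ e)           ≡⟨ cong₂ (λ a b → - μ e * B a + μ e * B b) n/ep≡mp^j n/e≡mp^j+1 ⟩
        - μ e * B (m ℕ.* p ℕ.^ j) + μ e * B (m ℕ.* p ℕ.^ suc j) ∼⟨ +-cong-mod (≡-mod-refl {x = - μ e * B (m ℕ.* p ℕ.^ j)}) (*-cong-mod (≡-mod-refl {x = μ e}) (B-cong j m)) ⟩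
        - μ e * B (m ℕ.* p ℕ.^ j) + μ e * B (m ℕ.* p ℕ.^ j)     ≡⟨ cancel (μ e) (B (m ℕ.* p ℕ.^ j)) ⟩
        + 0                                                     ∎
        where
        open ≡-mod-Reasoning (+ (p ℕ.^ suc j))
        instance
          e≢0 : NonZero e
          e≢0 = ℕ.≢-nonZero λ { refl → p∤e (p ℕ.∣0) }
          ep≢0 : NonZero (e ℕ.* p)
          ep≢0 = ℕ.m*n≢0 e p
        n≡mp^j*ep : n ≡ (m ℕ.* p ℕ.^ j) ℕ.* (e ℕ.* p)
        n≡mp^j*ep = trans n≡ce (trans (cong (ℕ._* e) c≡mp^j+1) (regroup m (p ℕ.^ j) e p))
          where
          regroup : ∀ m P e p → m ℕ.* (p ℕ.* P) ℕ.* e ≡ (m ℕ.* P) ℕ.* (e ℕ.* p)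
          regroup = ℕ.solve-∀
        n/e≡mp^j+1 : n /′ e ≡ m ℕ.* p ℕ.^ suc j
        n/e≡mp^j+1 = trans (/′≡/ n e) (trans (ℕ./-congˡ {o = e} n≡ce) (trans (ℕ.m*n/n≡m c e) c≡mp^j+1))
        n/ep≡mp^j : n /′ (e ℕ.* p) ≡ m ℕ.* p ℕ.^ j
        n/ep≡mp^j = trans (/′≡/ n (e ℕ.* p)) (trans (ℕ./-congˡ {o = e ℕ.* p} n≡mp^j*ep) (ℕ.m*n/n≡m (m ℕ.* p ℕ.^ j) (e ℕ.* p)))

      term≡0 : ∀ e → .{{NonZero e}} → term e ≡ + 0 mod + (p ℕ.^ suc j)
      term≡0 e with p ∣? e
      ... | yes p∣e = ≈⇒≡-mod (begin
        [ does (e ℕ.* p ∣? n) ]· (μ (e ℕ.* p) * B (n /′ (e ℕ.* p))) + + 0  ≡⟨ ℤ.+-identityʳ _ ⟩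
        [ does (e ℕ.* p ∣? n) ]· (μ (e ℕ.* p) * B (n /′ (e ℕ.* p)))        ≡⟨ cong (λ x → [ does (e ℕ.* p ∣? n) ]· (x * B (n /′ (e ℕ.* p)))) (μ-*-prime-∣ p-prime p∣e) ⟩
        [ does (e ℕ.* p ∣? n) ]· + 0                                       ≡⟨ [b]·0≡0 _ ⟩
        + 0                                                               ∎)
        where open ≡.≡-Reasoning
      ... | no p∤e = ≡-mod-trans (≈⇒≡-mod (cong₂ (λ b x → [ b ]· (x * B (n /′ (e ℕ.* p))) + g e) ep∣?n≡e∣?n (μ-*-prime p-prime p∤e))) paired
        where
        ep∣?n≡e∣?n : does (e ℕ.* p ∣? n) ≡ does (e ∣? n)
        ep∣?n≡e∣?n = does-cong (e ℕ.* p ∣? n) (e ∣? n) (ℕ.∣-trans (ℕ.m∣m*n p)) e∣n⇒ep∣n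
          where
          e∣n⇒ep∣n : e ∣ n → e ℕ.* p ∣ n
          e∣n⇒ep∣n (divides c n≡ce) with euclidsLemma c e p-prime (subst (p ∣_) n≡ce (ℕ.∣-trans (ℕ.m∣m*n (p ℕ.^ j)) p^j+1∣n))
          ... | inj₂ p∣e = contradiction p∣e p∤e
          ... | inj₁ (divides c′ refl) = divides c′ (trans n≡ce (trans (ℕ.*-assoc c′ p e) (cong (c′ ℕ.*_) (ℕ.*-comm p e))))
        paired : [ does (e ∣? n) ]· (- μ e * B (n /′ (e ℕ.* p))) + [ does (e ∣? n) ]· (μ e * B (n /′ e)) ≡ + 0 mod + (p ℕ.^ suc j)
        paired with e ∣? n
        ... | yes e∣n = paired≡0 p∤e e∣n
        ... | no _    = ≡-mod-refl

    möbius-transform≡0-mod : möbius-transform B n ≡ + 0 mod + (p ℕ.^ suc j)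
    möbius-transform≡0-mod = ≡-mod-trans (≈⇒≡-mod möbius-transform≡sum-of-terms) (sumTo≡0-mod n (λ {d} 1≤d _ → term≡0 d {{ℕ.>-nonZero 1≤d}}))

  dold-criterion : ∀ B → (∀ {p} → Prime p → ∀ j m → B (m ℕ.* p ℕ.^ suc j) ≡ B (m ℕ.* p ℕ.^ j) mod + (p ℕ.^ suc j)) → Dold B
  dold-criterion B B-cong n = ∣-by-prime-powers (λ {p} {j} p-prime p^j+1∣n → ≡0-mod⇒∣ (möbius-transform≡0-mod B p-prime (B-cong p-prime) {n} {j} p^j+1∣n))

-- Powers of a Lucas sequence

module LucasPowers (r₁ r₂ : ℤ) (U : ℕ → ℤ) (U-rec : IsLucasSeq r₁ r₂ U) (u : ℕ) where

  open QuadraticInteger r₁ r₂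
  open LucasSequence U U-rec
  private
    module ℤ-mod = IntegerCongruence

  c t : ℕ
  c = 2 ℕ.* ℤ.∣ D ∣
  t = suc u ℕ.* 2

  c≢0 : DistinctRoots r₁ r₂ → NonZero c
  c≢0 distinct = ℕ.m*n≢0 2 ℤ.∣ D ∣
    where
    instance
      ∣D∣≢0 : NonZero ℤ.∣ D ∣
      ∣D∣≢0 = ℕ.≢-nonZero (λ ∣D∣≡0 → distinct (ℤ.∣i∣≡0⇒i≡0 ∣D∣≡0))

  B : ℕ → ℤ
  B n = + c ℤ.* U (n ℕ.^ t)

  private

    U-step : ∀ {p i} j m → ξ ^ (p ℕ.^ (suc j ℕ.* t)) ≡ ξ ^ (p ℕ.^ (j ℕ.* t)) mod (p × 1ξ) ^ i →
             U ((m ℕ.* p ℕ.^ suc j) ℕ.^ t) ℤ-mod.≡ U ((m ℕ.* p ℕ.^ j) ℕ.^ t) mod + (p ℕ.^ i)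
    U-step {p} {i} j m ξ^≡ξ^ = subst₂ (λ a b → U a ℤ-mod.≡ U b mod + (p ℕ.^ i)) (sym (split (suc j))) (sym (split j))
      (U-cong-mod {p} {i} (ξ^-*-cong-mod (m ℕ.^ t) ξ^≡ξ^))
      where
      split : ∀ j → (m ℕ.* p ℕ.^ j) ℕ.^ t ≡ m ℕ.^ t ℕ.* p ℕ.^ (j ℕ.* t)
      split j = trans (^-distribʳ-* m (p ℕ.^ j) t) (cong (m ℕ.^ t ℕ.*_) (ℕ.^-*-assoc p j t))

    unramified : ∀ {p} → Prime p → ξ ^ (p ℕ.^ 2) ≡ ξ mod p × 1ξ → ∀ j m →
                 U ((m ℕ.* p ℕ.^ suc j) ℕ.^ t) ℤ-mod.≡ U ((m ℕ.* p ℕ.^ j) ℕ.^ t) mod + (p ℕ.^ suc j)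
    unramified {p} p-prime periodic j m = U-step {p} {suc j} j m (≡-mod-^-weaken {m = p × 1ξ} (s≤s (ℕ.m≤m*n j t))
      (periodic-lift-iterate p (≈⇒≡0-mod refl) 2 periodic (suc u) (j ℕ.* t)))

    -- One power of p short of what B-cong needs: the factor c of B supplies it.
    ramified : ∀ {p} → Prime p → ξ ^ (p ℕ.^ 4) ≡ ξ ^ (p ℕ.^ 2) mod p × 1ξ → ∀ j m →
               U ((m ℕ.* p ℕ.^ suc j) ℕ.^ t) ℤ-mod.≡ U ((m ℕ.* p ℕ.^ j) ℕ.^ t) mod + (p ℕ.^ j)
    ramified {p} p-prime periodic zero    m = ℤ-mod.≡-mod-one _ _
    ramified {p} p-prime periodic (suc j) m = U-step {p} {suc j} (suc j) m (begin
      ξ ^ (p ℕ.^ (suc (suc j) ℕ.* t))    ≡⟨ cong (λ k → ξ ^ (p ℕ.^ (2 ℕ.+ k))) (trans (ℕ.+-suc (u ℕ.* 2) (suc s)) (cong suc (ℕ.+-suc (u ℕ.* 2) s))) ⟩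
      ξ ^ (p ℕ.^ (2 ℕ.+ (t ℕ.+ s)))      ≡⟨ ^-p^-+ p 2 (t ℕ.+ s) ξ ⟨
      z ^ (p ℕ.^ (t ℕ.+ s))              ∼⟨ ≡-mod-^-weaken {m = p × 1ξ} (s≤s j≤s) (periodic-lift-iterate p (≈⇒≡0-mod refl) 2 z-periodic (suc u) s) ⟩
      z ^ (p ℕ.^ s)                      ≡⟨ ^-p^-+ p 2 s ξ ⟩
      ξ ^ (p ℕ.^ (suc j ℕ.* t))          ∎)
      where
      open ≡-mod-Reasoning ((p × 1ξ) ^ suc j)
      s : ℕ
      s = u ℕ.* 2 ℕ.+ j ℕ.* t
      z : ℤ[ξ]
      z = ξ ^ (p ℕ.^ 2)
      z-periodic : z ^ (p ℕ.^ 2) ≡ z mod p × 1ξ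
      z-periodic = ≡-mod-trans (≈⇒≡-mod (^-p^-+ p 2 2 ξ)) periodic
      j≤s : j ℕ.≤ s
      j≤s = ℕ.≤-trans (ℕ.m≤m*n j t) (ℕ.m≤n+m (j ℕ.* t) (u ℕ.* 2))

  B-cong : ∀ {p} → Prime p → ∀ j m → B (m ℕ.* p ℕ.^ suc j) ℤ-mod.≡ B (m ℕ.* p ℕ.^ j) mod + (p ℕ.^ suc j)
  B-cong {p} p-prime j m with p ∣? c
  ... | yes p∣c = ℤ-mod.*-cong-mod-multiple {k = j} p∣c (ramified p-prime (ξ-period-ramified p-prime p∣c) j m)
  ... | no p∤c  = ℤ-mod.*-cong-mod (ℤ-mod.≡-mod-refl {x = + c}) (unramified p-prime (ξ-period-unramified p-prime p∤c) j m)

open import Data.Nat using (_^_)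

corollary2 : (r₁ r₂ : ℤ) (U : ℕ → ℤ) → IsLucasSeq r₁ r₂ U → DistinctRoots r₁ r₂ →
    (t : ℕ) → .{{_ : NonZero t}} → 2 ∣ t → AlmostDold (λ n → U (n ^ t))
corollary2 r₁ r₂ U U-rec distinct t (divides zero t≡0)     = contradiction t≡0 (ℕ.≢-nonZero⁻¹ t)
corollary2 r₁ r₂ U U-rec distinct t (divides (suc u) refl) = c , c≢0 distinct , DoldCriterion.dold-criterion B B-cong
  where open LucasPowers r₁ r₂ U U-rec u
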